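{- For every integer $n>0$, the total number of Weyl-equivalence classes of words of length $n$ is $$\sum_{k=0}^n a(n,k)=2F_{n+4}-\begin{cases}(3n+42)\,2^{n/2-3}, & n \text{ even},\\ (n+15)\,2^{(n-3)/2}, & n\text{ odd},\end{cases}$$ where $F_m$ is the $m$-th Fibonacci number ($F_1=F_2=1$, $F_{m+2}=F_{m+1}+F_m$).
   Context: $\Bbbk$ is a field of characteristic $0$; $\mathcal{M}$ is the free monoid on letters $D,U$; $\mathcal{W}=\Bbbk\langle D,U\mid DU-UD=1\rangle$; $\phi:\mathcal{M}\to\mathcal{W}$ is the monoid morphism with $D\mapsto D,U\mapsto U$. Words $u,v$ are Weyl-equivalent if $\phi(u)=\phi(v)$. For $0\le k\le n$, $a(n,k)$ is the number of Weyl-equivalence classes of words with $k$ letters $D$ and $n-k$ letters $U$. -}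

module Defs where

open import Level using (Level; _⊔_)
open import Data.Nat using (ℕ; zero; suc)
import Data.Nat as ℕ
open import Data.List using (List; []; _∷_; _++_; length; concatMap; map; upTo)
open import Data.Nat.ListAction using (sum)
open import Data.List.Relation.Unary.All using (All)
open import Data.List.Relation.Unary.Any using (Any)
open import Data.List.Relation.Unary.AllPairs using (AllPairs)
open import Data.Product using (Σ; _×_; _,_; ∃)
open import Relation.Binary.PropositionalEquality using (_≡_)
open import Relation.Nullary using (¬_; yes; no)
open import Relation.Binary using (DecidableEquality)
open import Algebra.Bundles using (CommutativeRing)

data Letter : Set where
  D U : Letter

_≟L_ : DecidableEquality Letter
D ≟L D = yes _≡_.refl
D ≟L U = no λ ()
U ≟L D = no λ ()
U ≟L U = yes _≡_.refl

Word : Set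
Word = List Letter

_≟W_ : DecidableEquality Word
_≟W_ = Data.List.Properties.≡-dec _≟L_
  where import Data.List.Properties

countD : Word → ℕ
countD []      = 0
countD (D ∷ w) = suc (countD w)
countD (U ∷ w) = countD w

module _ {c ℓ : Level} (R : CommutativeRing c ℓ) where
  open CommutativeRing R

  natCast : ℕ → Carrier
  natCast zero    = 0#
  natCast (suc n) = 1# + natCast n

  record IsFieldChar0 : Set (c ⊔ ℓ) where
    field
      nontrivial : ¬ (0# ≈ 1#)
      inverse    : ∀ x → ¬ (x ≈ 0#) → ∃ λ y → x * y ≈ 1#
      char0      : ∀ n → ¬ (natCast (suc n) ≈ 0#)

  -- The free associative algebra k⟨D,U⟩: elements are finite formal
  -- linear combinations of words, represented as lists of
  -- (coefficient, word) pairs; two such lists denote the same element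
  -- iff every word has the same total coefficient.

  FreeElt : Set c
  FreeElt = List (Carrier × Word)

  coeff : Word → FreeElt → Carrier
  coeff w []             = 0#
  coeff w ((a , v) ∷ f) with v ≟W w
  ... | yes _ = a + coeff w f
  ... | no  _ = coeff w f

  _≈F_ : FreeElt → FreeElt → Set ℓ
  f ≈F g = ∀ w → coeff w f ≈ coeff w g

  generatorTerm : Carrier × Word × Word → FreeElt
  generatorTerm (x , a , b) =
      (x , a ++ (D ∷ U ∷ []) ++ b)
    ∷ (- x , a ++ (U ∷ D ∷ []) ++ b)
    ∷ (- x , a ++ b)
    ∷ []

  -- membership in the two-sided ideal I generated by DU - UD - 1:
  -- f is a finite sum of terms c · a (DU - UD - 1) b.
  InIdeal : FreeElt → Set (c ⊔ ℓ)
  InIdeal f = Σ (List (Carrier × Word × Word)) λ ts →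
                f ≈F concatMap generatorTerm ts

  -- The Weyl algebra is W = k⟨D,U⟩ / I and φ sends a word to its class;
  -- hence φ(u) = φ(v) iff u - v ∈ I.
  WeylEquiv : Word → Word → Set (c ⊔ ℓ)
  WeylEquiv u v = InIdeal ((1# , u) ∷ (- 1# , v) ∷ [])

-- Number of equivalence classes of a relation restricted to a set P of
-- words: N classes means there is a list of N representatives, all in
-- P, pairwise non-equivalent, such that every element of P is
-- equivalent to one of them.

NumClasses : {ℓ : Level} → (Word → Word → Set ℓ) → (Word → Set) → ℕ → Set ℓ
NumClasses _~_ P N =
  Σ (List Word) λ reps →
    (length reps ≡ N) × All P reps ×
    AllPairs (λ u v → ¬ (u ~ v)) reps ×
    (∀ w → P w → Any (λ r → w ~ r) reps)

WordsNK : ℕ → ℕ → Word → Set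
WordsNK n k w = (length w ≡ n) × (countD w ≡ k)

fib : ℕ → ℕ
fib 0             = 0
fib 1             = 1
fib (suc (suc m)) = fib (suc m) ℕ.+ fib m

sumTo : ℕ → (ℕ → ℕ) → ℕ
sumTo n f = sum (map f (upTo (suc n)))

-- Two words are Weyl-equivalent iff they have the same height #U - #D and the same multiset of
-- heights at their letters D.  Sufficiency: the normal ordering Σ Uᵃ Dᵇ of a word has a - b equal
-- to its height, and its exponents b satisfy Σ z⁽ᵇ⁾ = ∏ (z + h) over those heights; as falling
-- factorials form a basis, the product determines the normal ordering.  Necessity: w ↦ ∏ (ζ + h)
-- is a linear functional vanishing on the ideal generated by DU - UD - 1, and in characteristic 0
-- its values at ζ = 0, 1, 2, … determine the product, hence its roots.
-- Viewing a word as a lattice path, a class is fixed by how often each level is crossed: the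
-- excursions beyond the range between the two ends are compositions into even parts, counted by
-- powers of 2, and the part between the ends a composition into odd parts, counted by Fibonacci
-- numbers.  Convolving these counts and solving the resulting recurrences gives the closed form.

module Submission where

open import Defs
open import Level using (Level; _⊔_)
open import Algebra.Bundles using (CommutativeRing)
open import Data.Bool using (true; false; if_then_else_)
open import Data.Empty using (⊥; ⊥-elim)
open import Data.Nat as ℕ using (ℕ; zero; suc; z≤n; s≤s)
import Data.Nat.Properties as ℕ
import Data.Nat.Divisibility as ℕ
open import Data.Nat.ListAction using (sum)
open import Data.Integer as ℤ using (ℤ; 0ℤ; 1ℤ; -1ℤ)
import Data.Integer.Properties as ℤ
open import Data.Product using (Σ; ∃₂; _×_; _,_; proj₁; proj₂; map₁)
open import Data.Sum using (inj₁; inj₂)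
open import Data.List
  using (List; []; _∷_; _++_; [_]; map; concatMap; replicate; foldr; length; filter; drop; take;
         deduplicate; cartesianProduct; applyUpTo; upTo)
open import Data.List.Properties
  using (++-assoc; map-++; map-∘; map-concatMap; map-replicate; concatMap-++; length-++; length-map;
         length-replicate; filter-++; filter-all; filter-none; take++drop≡id; map-applyUpTo; ∷-injectiveʳ)
open import Data.List.Relation.Unary.All as All using (All; []; _∷_)
import Data.List.Relation.Unary.All.Properties as All
open import Data.List.Relation.Unary.Any as Any using (Any; here; there)
open import Data.List.Relation.Unary.AllPairs as AllPairs using (AllPairs; []; _∷_)
import Data.List.Relation.Unary.AllPairs.Properties as AllPairs
open import Data.List.Relation.Unary.Unique.Propositional using (Unique)
import Data.List.Relation.Unary.Unique.Propositional.Properties as Unique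
open import Data.List.Relation.Unary.Unique.DecPropositional.Properties using (deduplicate-!)
open import Data.List.Membership.Propositional using (_∈_)
open import Data.List.Membership.Propositional.Properties
  using (∈-++⁺ˡ; ∈-++⁺ʳ; ∈-++⁻; ∈-map⁺; ∈-map⁻; ∈-∃++; ∈-deduplicate⁺; ∈-filter⁺; ∈-filter⁻;
         ∈-cartesianProduct⁺; ∈-cartesianProduct⁻)
open import Data.List.Relation.Binary.Permutation.Propositional as ↭
  using (_↭_; prep; ↭-refl; ↭-sym; ↭-trans; ↭-reflexive; ↭⇒↭ₛ; ↭⇒↭ₛ′; module PermutationReasoning)
import Data.List.Relation.Binary.Permutation.Propositional.Properties as ↭
open import Function using (_∘_)
open import Relation.Nullary using (¬_; yes; no; does; contradiction)
open import Relation.Binary.PropositionalEquality as ≡ using (_≡_; _≢_)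

height : Word → ℤ
height []      = 0ℤ
height (U ∷ w) = 1ℤ ℤ.+ height w
height (D ∷ w) = -1ℤ ℤ.+ height w

-- The letter D of a word w = x ++ D ∷ y is recorded at the height of y.
downHeights : Word → List ℤ
downHeights []      = []
downHeights (U ∷ w) = downHeights w
downHeights (D ∷ w) = height w ∷ downHeights w

module NormalOrdering where
  open ≡ using (refl; cong; sym; trans)

  -- L ≋ M: the sums of the words of L and of M are equal in the Weyl algebra.
  infix 4 _≋_
  data _≋_ : List Word → List Word → Set where
    commute : ∀ a b → [ a ++ D ∷ U ∷ b ] ≋ (a ++ U ∷ D ∷ b) ∷ (a ++ b) ∷ []
    ↭⇒≋     : ∀ {L M} → L ↭ M → L ≋ M
    ≋-sym   : ∀ {L M} → L ≋ M → M ≋ L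
    ≋-trans : ∀ {L M N} → L ≋ M → M ≋ N → L ≋ N
    ≋-++    : ∀ {L L′ M M′} → L ≋ L′ → M ≋ M′ → L ++ M ≋ L′ ++ M′

  ≡⇒≋ : ∀ {L M} → L ≡ M → L ≋ M
  ≡⇒≋ refl = ↭⇒≋ ↭-refl

  ≋-prefix : ∀ x {L M} → L ≋ M → map (x ∷_) L ≋ map (x ∷_) M
  ≋-prefix x (commute a b) = commute (x ∷ a) b
  ≋-prefix x (↭⇒≋ p)       = ↭⇒≋ (↭.map⁺ (x ∷_) p)
  ≋-prefix x (≋-sym p)     = ≋-sym (≋-prefix x p)
  ≋-prefix x (≋-trans p q) = ≋-trans (≋-prefix x p) (≋-prefix x q)
  ≋-prefix x (≋-++ {L} {L′} {M} {M′} p q) =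
    ≋-trans (≡⇒≋ (map-++ (x ∷_) L M))
      (≋-trans (≋-++ (≋-prefix x p) (≋-prefix x q)) (≡⇒≋ (sym (map-++ (x ∷_) L′ M′))))

  ≋-concatMap : ∀ {A : Set} (f : A → Word) (g : A → List Word) →
                (∀ p → [ f p ] ≋ g p) → ∀ L → map f L ≋ concatMap g L
  ≋-concatMap f g f≋g []      = ↭⇒≋ ↭-refl
  ≋-concatMap f g f≋g (p ∷ L) = ≋-++ (f≋g p) (≋-concatMap f g f≋g L)

  normalWord : ℕ × ℕ → Word
  normalWord (a , b) = replicate a U ++ replicate b D

  -- D Uᵃ Dᵇ = Uᵃ Dᵇ⁺¹ + a Uᵃ⁻¹ Dᵇ.
  D∙normal : ℕ × ℕ → List (ℕ × ℕ)
  D∙normal (a , b) = (a , suc b) ∷ replicate a (ℕ.pred a , b)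

  ≋-D∙normal : ∀ a b → [ D ∷ normalWord (a , b) ] ≋ map normalWord (D∙normal (a , b))
  ≋-D∙normal zero    b = ↭⇒≋ ↭-refl
  ≋-D∙normal (suc a) b =
    ≋-trans (commute [] (normalWord (a , b)))
      (≋-trans (≋-++ (≋-prefix U (≋-D∙normal a b)) (↭⇒≋ ↭-refl))
        (↭⇒≋ (prep _ (↭-trans (↭.++⁺ʳ _ (↭-reflexive (raise a))) (↭.++-comm _ [ normalWord (a , b) ])))))
    where
    raise : ∀ n → map (U ∷_) (map normalWord (replicate n (ℕ.pred n , b))) ≡ map normalWord (replicate n (n , b))
    raise zero    = refl
    raise (suc n) = go (suc n)
      where
      go : ∀ k → map (U ∷_) (map normalWord (replicate k (n , b))) ≡ map normalWord (replicate k (suc n , b))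
      go zero    = refl
      go (suc k) = cong (normalWord (suc n , b) ∷_) (go k)

  normalOrder : Word → List (ℕ × ℕ)
  normalOrder []      = [ (0 , 0) ]
  normalOrder (U ∷ w) = map (map₁ suc) (normalOrder w)
  normalOrder (D ∷ w) = concatMap D∙normal (normalOrder w)

  ≋-normalOrder : ∀ w → [ w ] ≋ map normalWord (normalOrder w)
  ≋-normalOrder []      = ↭⇒≋ ↭-refl
  ≋-normalOrder (U ∷ w) =
    ≋-trans (≋-prefix U (≋-normalOrder w))
      (≡⇒≋ (trans (sym (map-∘ (normalOrder w))) (map-∘ (normalOrder w))))
  ≋-normalOrder (D ∷ w) =
    ≋-trans (≋-prefix D (≋-normalOrder w))
      (≋-trans (≡⇒≋ (sym (map-∘ (normalOrder w))))
        (≋-trans (≋-concatMap _ _ (λ (a , b) → ≋-D∙normal a b) (normalOrder w))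
          (≡⇒≋ (sym (map-concatMap normalWord D∙normal (normalOrder w))))))

open NormalOrdering

module FallingFactorials where
  open import Data.Nat using (_+_; _*_; _<_; _≤_)
  open import Data.Nat.Tactic.RingSolver using (solve-∀)
  open ≡ using (refl; cong; sym; trans)

  fall : ℕ → ℕ → ℕ
  fall N       zero    = 1
  fall zero    (suc b) = 0
  fall (suc N) (suc b) = suc N * fall N b

  fallSum : ℕ → List ℕ → ℕ
  fallSum N bs = sum (map (fall N) bs)

  zeros : List ℕ → ℕ
  zeros []           = 0
  zeros (zero  ∷ bs) = suc (zeros bs)
  zeros (suc _ ∷ bs) = zeros bs

  positivesPred : List ℕ → List ℕ
  positivesPred []           = []
  positivesPred (zero  ∷ bs) = positivesPred bs
  positivesPred (suc b ∷ bs) = b ∷ positivesPred bs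

  ↭-zeros++positives : ∀ bs → bs ↭ replicate (zeros bs) 0 ++ map suc (positivesPred bs)
  ↭-zeros++positives []           = ↭-refl
  ↭-zeros++positives (zero  ∷ bs) = prep 0 (↭-zeros++positives bs)
  ↭-zeros++positives (suc b ∷ bs) =
    ↭-trans (prep (suc b) (↭-zeros++positives bs)) (↭-sym (↭.shift (suc b) (replicate (zeros bs) 0) _))

  fallSum-zero : ∀ bs → fallSum 0 bs ≡ zeros bs
  fallSum-zero []           = refl
  fallSum-zero (zero  ∷ bs) = cong suc (fallSum-zero bs)
  fallSum-zero (suc _ ∷ bs) = fallSum-zero bs

  fallSum-suc : ∀ N bs → fallSum (suc N) bs ≡ zeros bs + suc N * fallSum N (positivesPred bs)
  fallSum-suc N []           = sym (ℕ.*-zeroʳ (suc N))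
  fallSum-suc N (zero  ∷ bs) = cong suc (fallSum-suc N bs)
  fallSum-suc N (suc b ∷ bs) =
    trans (cong (suc N * fall N b +_) (fallSum-suc N bs)) (lemma (suc N) (fall N b) (zeros bs) (fallSum N (positivesPred bs)))
    where
    lemma : ∀ n x z q → n * x + (z + n * q) ≡ z + n * (x + q)
    lemma = solve-∀

  -- The falling factorials are a basis: triangularity at N = 0, 1, 2, … recovers a multiset.
  fallSum-injective : ∀ bs cs → (∀ N → fallSum N bs ≡ fallSum N cs) → bs ↭ cs
  fallSum-injective bs cs eq =
    let bs< , cs< = All.++⁻ bs (All.map s≤s (≤-sum (bs ++ cs))) in bounded _ bs cs bs< cs< eq
    where
    ≤-sum : ∀ bs → All (_≤ sum bs) bs
    ≤-sum []       = []
    ≤-sum (b ∷ bs) = ℕ.m≤m+n b (sum bs) ∷ All.map (λ p → ℕ.≤-trans p (ℕ.m≤n+m _ b)) (≤-sum bs)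

    positivesPred-< : ∀ {K} bs → All (_< suc K) bs → All (_< K) (positivesPred bs)
    positivesPred-< []           []            = []
    positivesPred-< (zero  ∷ bs) (_ ∷ bs<)     = positivesPred-< bs bs<
    positivesPred-< (suc b ∷ bs) (s≤s b< ∷ bs<) = b< ∷ positivesPred-< bs bs<

    bounded : ∀ K bs cs → All (_< K) bs → All (_< K) cs →
              (∀ N → fallSum N bs ≡ fallSum N cs) → bs ↭ cs
    bounded zero    []      []      _         _         _  = ↭-refl
    bounded zero    (_ ∷ _) _       (() ∷ _)  _         _
    bounded zero    []      (_ ∷ _) _         (() ∷ _)  _
    bounded (suc K) bs      cs      bs<       cs<       eq = begin
      bs                                                     ↭⟨ ↭-zeros++positives bs ⟩
      replicate (zeros bs) 0 ++ map suc (positivesPred bs)   ↭⟨ ↭.++⁺ (↭-reflexive (cong (λ n → replicate n 0) zeros≡))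
                                                                      (↭.map⁺ suc positives↭) ⟩
      replicate (zeros cs) 0 ++ map suc (positivesPred cs)   ↭⟨ ↭-sym (↭-zeros++positives cs) ⟩
      cs                                                     ∎
      where
      open PermutationReasoning
      zeros≡ : zeros bs ≡ zeros cs
      zeros≡ = trans (sym (fallSum-zero bs)) (trans (eq 0) (fallSum-zero cs))
      positives≡ : ∀ N → fallSum N (positivesPred bs) ≡ fallSum N (positivesPred cs)
      positives≡ N = ℕ.*-cancelˡ-≡ _ _ (suc N) (ℕ.+-cancelˡ-≡ (zeros bs) _ _
        (trans (sym (fallSum-suc N bs))
          (trans (eq (suc N)) (trans (fallSum-suc N cs) (cong (_+ _) (sym zeros≡))))))
      positives↭ : positivesPred bs ↭ positivesPred cs
      positives↭ = bounded K _ _ (positivesPred-< bs bs<) (positivesPred-< cs cs<) positives≡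

open FallingFactorials

module LinearProducts where
  open import Data.Integer using (+_; ∣_∣; _+_; _-_; _*_; -_)
  open import Data.Integer.Tactic.RingSolver using (solve-∀)
  open import Data.Integer.Divisibility.Signed
    using (_∣_; divides; ∣-refl; ∣n⇒∣m*n; ∣m⇒∣m*n; ∣m∣n⇒∣m+n; ∣m∣n⇒∣m-n; ∣⇒∣ᵤ)
  open import Data.List.Relation.Binary.Permutation.Setoid.Properties (≡.setoid ℤ) using (foldr-commMonoid)
  open import Algebra.Properties.AbelianGroup ℤ.+-0-abelianGroup using (inverseˡ-unique; inverseʳ-unique)
  open ≡ using (refl; cong; sym; trans; subst; subst₂)

  linearProduct : List ℤ → ℤ → ℤ
  linearProduct A z = foldr _*_ 1ℤ (map (λ a → z + a) A)

  linearProduct-↭ : ∀ {A B} → A ↭ B → ∀ z → linearProduct A z ≡ linearProduct B z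
  linearProduct-↭ p z = foldr-commMonoid ℤ.*-1-isCommutativeMonoid (↭⇒↭ₛ (↭.map⁺ (λ a → z + a) p))

  linearProduct-∣ : ∀ A x y → (x - y) ∣ (linearProduct A x - linearProduct A y)
  linearProduct-∣ []      x y = divides 0ℤ (sym (ℤ.*-zeroˡ (x - y)))
  linearProduct-∣ (a ∷ A) x y =
    subst ((x - y) ∣_) (expand x y a (linearProduct A x) (linearProduct A y))
      (∣m∣n⇒∣m+n (∣n⇒∣m*n (x + a) (linearProduct-∣ A x y)) (∣m⇒∣m*n (linearProduct A y) ∣-refl))
    where
    expand : ∀ x y a p q → (x + a) * (p - q) + (x - y) * q ≡ (x + a) * p - (y + a) * q
    expand = solve-∀

  private
    suc∣⇒≡0 : ∀ {n} → suc n ℕ.∣ n → n ≡ 0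
    suc∣⇒≡0 {zero}  _ = refl
    suc∣⇒≡0 {suc n} p = ⊥-elim (ℕ.<-irrefl refl (ℕ.∣⇒≤ p))

  -- Agreement everywhere but at z₀ forces agreement at z₀: for t = z₀ + 1 + |d|, where d is the
  -- difference at z₀, t - z₀ divides d.
  linearProduct-agree : ∀ A B z₀ → (∀ z → z ≢ z₀ → linearProduct A z ≡ linearProduct B z) →
                        linearProduct A z₀ ≡ linearProduct B z₀
  linearProduct-agree A B z₀ agree = ℤ.i-j≡0⇒i≡j _ _ (ℤ.∣i∣≡0⇒i≡0 (suc∣⇒≡0 (∣⇒∣ᵤ t-z₀∣d)))
    where
    d = linearProduct A z₀ - linearProduct B z₀
    t = z₀ + + suc ∣ d ∣
    t-z₀ : t - z₀ ≡ + suc ∣ d ∣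
    t-z₀ = shift z₀ (+ suc ∣ d ∣)
      where
      shift : ∀ z m → (z + m) - z ≡ m
      shift = solve-∀
    t≢z₀ : t ≢ z₀
    t≢z₀ t≡z₀ with trans (sym t-z₀) (trans (cong (_- z₀) t≡z₀) (ℤ.+-inverseʳ z₀))
    ... | ()
    t-z₀∣d : (+ suc ∣ d ∣) ∣ d
    t-z₀∣d = subst₂ _∣_ t-z₀ (difference (agree t t≢z₀))
               (∣m∣n⇒∣m-n (linearProduct-∣ B t z₀) (linearProduct-∣ A t z₀))
      where
      difference : ∀ {at bt} → at ≡ bt → (bt - linearProduct B z₀) - (at - linearProduct A z₀) ≡ d
      difference {at} refl = cancel at (linearProduct A z₀) (linearProduct B z₀)
        where
        cancel : ∀ x a b → (x - b) - (x - a) ≡ a - b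
        cancel = solve-∀

  linearProduct-root : ∀ B z → linearProduct B z ≡ 0ℤ → - z ∈ B
  linearProduct-root []      z ()
  linearProduct-root (b ∷ B) z eq with ℤ.i*j≡0⇒i≡0∨j≡0 (z + b) eq
  ... | inj₁ z+b≡0 = here (sym (inverseʳ-unique z b z+b≡0))
  ... | inj₂ rest  = there (linearProduct-root B z rest)

  linearProduct-vanishes : ∀ a A → linearProduct (a ∷ A) (- a) ≡ 0ℤ
  linearProduct-vanishes a A =
    trans (cong (_* linearProduct A (- a)) (ℤ.+-inverseˡ a)) (ℤ.*-zeroˡ (linearProduct A (- a)))

  linearProduct-injective : ∀ A B → (∀ z → linearProduct A z ≡ linearProduct B z) → A ↭ B
  linearProduct-injective []      []      _  = ↭-refl
  linearProduct-injective []      (b ∷ B) eq with trans (eq (- b)) (linearProduct-vanishes b B)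
  ... | ()
  linearProduct-injective (a ∷ A) B       eq
    with ys , zs , refl ← ∈-∃++ (subst (_∈ B) (ℤ.neg-involutive a)
                                    (linearProduct-root B (- a) (trans (sym (eq (- a))) (linearProduct-vanishes a A))))
    = ↭-trans (prep a (linearProduct-injective A (ys ++ zs) eq′)) (↭-sym (↭.shift a ys zs))
    where
    eq-cons : ∀ z → (z + a) * linearProduct A z ≡ (z + a) * linearProduct (ys ++ zs) z
    eq-cons z = trans (eq z) (linearProduct-↭ (↭.shift a ys zs) z)
    eq-away : ∀ z → z ≢ - a → linearProduct A z ≡ linearProduct (ys ++ zs) z
    eq-away z z≢-a = ℤ.*-cancelˡ-≡ (z + a) _ _ {{ℤ.≢-nonZero z+a≢0}} (eq-cons z)
      where
      z+a≢0 : z + a ≢ 0ℤ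
      z+a≢0 z+a≡0 = z≢-a (inverseˡ-unique z a z+a≡0)
    eq′ : ∀ z → linearProduct A z ≡ linearProduct (ys ++ zs) z
    eq′ z with z ℤ.≟ - a
    ... | no  z≢-a = eq-away z z≢-a
    ... | yes refl = linearProduct-agree A (ys ++ zs) (- a) eq-away

open LinearProducts

module NormalOrderingAndHeights where
  open import Data.Integer using (+_; ∣_∣; _+_; _-_; _*_)
  open import Data.Integer.Tactic.RingSolver using (solve-∀)
  open import Data.List.Relation.Binary.Permutation.Setoid.Properties (≡.setoid ℤ) using (foldr-commMonoid)
  open ≡ using (refl; cong; cong₂; sym; trans; subst₂)
  open ≡.≡-Reasoning

  fallℤ : ℤ → ℕ → ℤ
  fallℤ z zero    = 1ℤ
  fallℤ z (suc b) = fallℤ z b * (z - + b)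

  fallℤ-suc : ∀ z b → fallℤ z (suc b) ≡ z * fallℤ (z - 1ℤ) b
  fallℤ-suc z zero    = lemma z
    where
    lemma : ∀ z → 1ℤ * (z - 0ℤ) ≡ z * 1ℤ
    lemma = solve-∀
  fallℤ-suc z (suc b) = begin
    fallℤ z (suc b) * (z - + suc b)               ≡⟨ cong₂ (λ x y → x * (z - y)) (fallℤ-suc z b) (ℤ.pos-+ 1 b) ⟩
    z * fallℤ (z - 1ℤ) b * (z - (1ℤ + + b))      ≡⟨ lemma z (fallℤ (z - 1ℤ) b) (+ b) ⟩
    z * (fallℤ (z - 1ℤ) b * (z - 1ℤ - + b))      ∎
    where
    lemma : ∀ z x b → z * x * (z - (1ℤ + b)) ≡ z * (x * (z - 1ℤ - b))
    lemma = solve-∀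

  fall-cast : ∀ N b → + fall N b ≡ fallℤ (+ N) b
  fall-cast N       zero    = refl
  fall-cast zero    (suc b) = sym (trans (fallℤ-suc 0ℤ b) (ℤ.*-zeroˡ (fallℤ -1ℤ b)))
  fall-cast (suc N) (suc b) = begin
    + (suc N ℕ.* fall N b)         ≡⟨ ℤ.pos-* (suc N) (fall N b) ⟩
    + suc N * + fall N b           ≡⟨ cong (+ suc N *_) (fall-cast N b) ⟩
    + suc N * fallℤ (+ N) b        ≡⟨ sym (fallℤ-suc (+ suc N) b) ⟩
    fallℤ (+ suc N) (suc b)        ∎

  fallSumℤ : ℤ → List ℕ → ℤ
  fallSumℤ z bs = foldr _+_ 0ℤ (map (fallℤ z) bs)

  fallSum-cast : ∀ N bs → + fallSum N bs ≡ fallSumℤ (+ N) bs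
  fallSum-cast N []       = refl
  fallSum-cast N (b ∷ bs) = trans (ℤ.pos-+ (fall N b) (fallSum N bs)) (cong₂ _+_ (fall-cast N b) (fallSum-cast N bs))

  fallSumℤ-++ : ∀ z bs cs → fallSumℤ z (bs ++ cs) ≡ fallSumℤ z bs + fallSumℤ z cs
  fallSumℤ-++ z []       cs = sym (ℤ.+-identityˡ _)
  fallSumℤ-++ z (b ∷ bs) cs =
    trans (cong (λ s → fallℤ z b + s) (fallSumℤ-++ z bs cs)) (sym (ℤ.+-assoc (fallℤ z b) (fallSumℤ z bs) (fallSumℤ z cs)))

  fallSumℤ-↭ : ∀ {bs cs} → bs ↭ cs → ∀ z → fallSumℤ z bs ≡ fallSumℤ z cs
  fallSumℤ-↭ p z = foldr-commMonoid ℤ.+-0-isCommutativeMonoid (↭⇒↭ₛ (↭.map⁺ (fallℤ z) p))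

  fallSumℤ-replicate : ∀ z n b → fallSumℤ z (replicate n b) ≡ + n * fallℤ z b
  fallSumℤ-replicate z zero    b = sym (ℤ.*-zeroˡ (fallℤ z b))
  fallSumℤ-replicate z (suc n) b = begin
    fallℤ z b + fallSumℤ z (replicate n b)   ≡⟨ cong (λ s → fallℤ z b + s) (fallSumℤ-replicate z n b) ⟩
    fallℤ z b + + n * fallℤ z b              ≡⟨ lemma (+ n) (fallℤ z b) ⟩
    (1ℤ + + n) * fallℤ z b                   ≡⟨ cong (_* fallℤ z b) (sym (ℤ.pos-+ 1 n)) ⟩
    + suc n * fallℤ z b                      ∎
    where
    lemma : ∀ n f → f + n * f ≡ (1ℤ + n) * f
    lemma = solve-∀

  HasHeight : ℤ → ℕ × ℕ → Set
  HasHeight h (a , b) = + a - + b ≡ h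

  HasHeight-U : ∀ {h p} → HasHeight h p → HasHeight (1ℤ + h) (map₁ suc p)
  HasHeight-U {p = a , b} refl = lemma (+ a) (+ b)
    where
    lemma : ∀ a b → 1ℤ + a - b ≡ 1ℤ + (a - b)
    lemma = solve-∀

  HasHeight-D∙normal : ∀ {h p} → HasHeight h p → All (HasHeight (-1ℤ + h)) (D∙normal p)
  HasHeight-D∙normal {p = a , b} refl = lemma₁ (+ a) (+ b) ∷ lowered a
    where
    lemma₁ : ∀ a b → a - (1ℤ + b) ≡ -1ℤ + (a - b)
    lemma₁ = solve-∀
    lemma₂ : ∀ a b → a - b ≡ -1ℤ + (1ℤ + a - b)
    lemma₂ = solve-∀
    lowered : ∀ a → All (HasHeight (-1ℤ + (+ a - + b))) (replicate a (ℕ.pred a , b))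
    lowered zero    = []
    lowered (suc a) = All.replicate⁺ (suc a) (lemma₂ (+ a) (+ b))

  normalOrder-height : ∀ w → All (HasHeight (height w)) (normalOrder w)
  normalOrder-height []      = refl ∷ []
  normalOrder-height (U ∷ w) = All.map⁺ (All.map (λ {p} → HasHeight-U {p = p}) (normalOrder-height w))
  normalOrder-height (D ∷ w) = All.concat⁺ (All.map⁺ (All.map (λ {p} → HasHeight-D∙normal {p = p}) (normalOrder-height w)))

  -- x · x⁽ᵇ⁾ = x⁽ᵇ⁺¹⁾ + b · x⁽ᵇ⁾ makes a letter D act on falling factorials as multiplication by z + h.
  fallSumℤ-D∙normal : ∀ z {h p} → HasHeight h p →
                      fallSumℤ z (map proj₂ (D∙normal p)) ≡ (z + h) * fallℤ z (proj₂ p)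
  fallSumℤ-D∙normal z {p = a , b} refl = begin
    fallℤ z (suc b) + fallSumℤ z (map proj₂ (replicate a (ℕ.pred a , b)))
      ≡⟨ cong (λ bs → fallℤ z (suc b) + fallSumℤ z bs) (map-replicate proj₂ a _) ⟩
    fallℤ z b * (z - + b) + fallSumℤ z (replicate a b)
      ≡⟨ cong (λ s → fallℤ z b * (z - + b) + s) (fallSumℤ-replicate z a b) ⟩
    fallℤ z b * (z - + b) + + a * fallℤ z b
      ≡⟨ lemma z (+ a) (+ b) (fallℤ z b) ⟩
    (z + (+ a - + b)) * fallℤ z b
      ∎
    where
    lemma : ∀ z a b f → f * (z - b) + a * f ≡ (z + (a - b)) * f
    lemma = solve-∀

  normalDExps : Word → List ℕ
  normalDExps w = map proj₂ (normalOrder w)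

  fallSumℤ-normalDExps : ∀ w z → fallSumℤ z (normalDExps w) ≡ linearProduct (downHeights w) z
  fallSumℤ-normalDExps []      z = refl
  fallSumℤ-normalDExps (U ∷ w) z =
    trans (cong (fallSumℤ z) (sym (map-∘ (normalOrder w)))) (fallSumℤ-normalDExps w z)
  fallSumℤ-normalDExps (D ∷ w) z = begin
    fallSumℤ z (map proj₂ (concatMap D∙normal (normalOrder w)))
      ≡⟨ D-step (normalOrder w) (normalOrder-height w) ⟩
    (z + height w) * fallSumℤ z (normalDExps w)
      ≡⟨ cong ((z + height w) *_) (fallSumℤ-normalDExps w z) ⟩
    (z + height w) * linearProduct (downHeights w) z
      ∎
    where
    D-step : ∀ L → All (HasHeight (height w)) L →
             fallSumℤ z (map proj₂ (concatMap D∙normal L)) ≡ (z + height w) * fallSumℤ z (map proj₂ L)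
    D-step []      []       = sym (ℤ.*-zeroʳ (z + height w))
    D-step (p ∷ L) (hp ∷ hL) = begin
      fallSumℤ z (map proj₂ (D∙normal p ++ concatMap D∙normal L))
        ≡⟨ cong (fallSumℤ z) (map-++ proj₂ (D∙normal p) _) ⟩
      fallSumℤ z (map proj₂ (D∙normal p) ++ map proj₂ (concatMap D∙normal L))
        ≡⟨ fallSumℤ-++ z (map proj₂ (D∙normal p)) _ ⟩
      fallSumℤ z (map proj₂ (D∙normal p)) + fallSumℤ z (map proj₂ (concatMap D∙normal L))
        ≡⟨ cong₂ _+_ (fallSumℤ-D∙normal z {p = p} hp) (D-step L hL) ⟩
      (z + height w) * fallℤ z (proj₂ p) + (z + height w) * fallSumℤ z (map proj₂ L)
        ≡⟨ sym (ℤ.*-distribˡ-+ (z + height w) _ _) ⟩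
      (z + height w) * fallSumℤ z (map proj₂ (p ∷ L))
        ∎

  withHeight : ℤ → ℕ → ℕ × ℕ
  withHeight h b = ∣ h + + b ∣ , b

  normalOrder-determined : ∀ w → normalOrder w ≡ map (withHeight (height w)) (normalDExps w)
  normalOrder-determined w = go (normalOrder w) (normalOrder-height w)
    where
    go : ∀ {h} L → All (HasHeight h) L → L ≡ map (withHeight h) (map proj₂ L)
    go []            []          = refl
    go ((a , b) ∷ L) (refl ∷ hL) = cong₂ _∷_ (cong (λ t → ∣ t ∣ , b) (sym (lemma (+ a) (+ b)))) (go L hL)
      where
      lemma : ∀ a b → a - b + b ≡ a
      lemma = solve-∀

  downHeights-↭⇒normalOrder-↭ : ∀ {u v} → height u ≡ height v → downHeights u ↭ downHeights v →
                                  normalOrder u ↭ normalOrder v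
  downHeights-↭⇒normalOrder-↭ {u} {v} hu≡hv p =
    subst₂ _↭_ (sym (normalOrder-determined u))
      (trans (cong (λ h → map (withHeight h) (normalDExps v)) hu≡hv) (sym (normalOrder-determined v)))
      (↭.map⁺ (withHeight (height u)) exps↭)
    where
    exps↭ : normalDExps u ↭ normalDExps v
    exps↭ = fallSum-injective _ _ λ N → ℤ.+-injective (begin
      + fallSum N (normalDExps u)                ≡⟨ fallSum-cast N (normalDExps u) ⟩
      fallSumℤ (+ N) (normalDExps u)             ≡⟨ fallSumℤ-normalDExps u (+ N) ⟩
      linearProduct (downHeights u) (+ N)        ≡⟨ linearProduct-↭ p (+ N) ⟩
      linearProduct (downHeights v) (+ N)        ≡⟨ fallSumℤ-normalDExps v (+ N) ⟨
      fallSumℤ (+ N) (normalDExps v)             ≡⟨ fallSum-cast N (normalDExps v) ⟨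
      + fallSum N (normalDExps v)                ∎)

  fallSum≡⇒downHeights-↭ : ∀ {u v} → (∀ N → fallSum N (normalDExps u) ≡ fallSum N (normalDExps v)) →
                            downHeights u ↭ downHeights v
  fallSum≡⇒downHeights-↭ {u} {v} eq = linearProduct-injective _ _ λ z → begin
    linearProduct (downHeights u) z     ≡⟨ fallSumℤ-normalDExps u z ⟨
    fallSumℤ z (normalDExps u)          ≡⟨ fallSumℤ-↭ (fallSum-injective (normalDExps u) (normalDExps v) eq) z ⟩
    fallSumℤ z (normalDExps v)          ≡⟨ fallSumℤ-normalDExps v z ⟩
    linearProduct (downHeights v) z     ∎

open NormalOrderingAndHeights

module WeylAlgebra {c ℓ : Level} (R : CommutativeRing c ℓ) where
  open CommutativeRing R
  open import Relation.Binary.Reasoning.Setoid setoid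
  open import Algebra.Properties.Group +-group using (ε⁻¹≈ε; x≈y⇒x∙y⁻¹≈ε; x∙y⁻¹≈ε⇒x≈y)
  open import Algebra.Properties.AbelianGroup +-abelianGroup using (⁻¹-∙-comm; ⁻¹-anti-homo‿-)
  open import Algebra.Properties.CommutativeSemigroup +-commutativeSemigroup using (interchange; x∙yz≈y∙xz)
  open import Algebra.Properties.Ring ring using (-‿distribˡ-*)
  open import Data.List.Relation.Binary.Permutation.Setoid.Properties setoid using (foldr-commMonoid)

  δ : Carrier → Word → Word → Carrier
  δ x v w with v ≟W w
  ... | yes _ = x
  ... | no  _ = 0#

  coeff-∷ : ∀ w x v f → coeff R w ((x , v) ∷ f) ≈ δ x v w + coeff R w f
  coeff-∷ w x v f with v ≟W w
  ... | yes _ = refl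
  ... | no  _ = sym (+-identityˡ _)

  coeff-++ : ∀ w f g → coeff R w (f ++ g) ≈ coeff R w f + coeff R w g
  coeff-++ w []            g = sym (+-identityˡ _)
  coeff-++ w ((x , v) ∷ f) g = begin
    coeff R w ((x , v) ∷ f ++ g)              ≈⟨ coeff-∷ w x v (f ++ g) ⟩
    δ x v w + coeff R w (f ++ g)              ≈⟨ +-congˡ (coeff-++ w f g) ⟩
    δ x v w + (coeff R w f + coeff R w g)     ≈⟨ +-assoc _ _ _ ⟨
    (δ x v w + coeff R w f) + coeff R w g     ≈⟨ +-congʳ (coeff-∷ w x v f) ⟨
    coeff R w ((x , v) ∷ f) + coeff R w g     ∎

  coeff-↭ : ∀ w {f g} → f ↭ g → coeff R w f ≈ coeff R w g
  coeff-↭ w ↭.refl                = refl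
  coeff-↭ w (↭.prep (x , v) p)    =
    trans (coeff-∷ w x v _) (trans (+-congˡ (coeff-↭ w p)) (sym (coeff-∷ w x v _)))
  coeff-↭ w (↭.swap {f} {g} (x , v) (y , u) p) = begin
    coeff R w ((x , v) ∷ (y , u) ∷ f)         ≈⟨ trans (coeff-∷ w x v _) (+-congˡ (coeff-∷ w y u f)) ⟩
    δ x v w + (δ y u w + coeff R w f)         ≈⟨ +-congˡ (+-congˡ (coeff-↭ w p)) ⟩
    δ x v w + (δ y u w + coeff R w g)         ≈⟨ x∙yz≈y∙xz _ _ _ ⟩
    δ y u w + (δ x v w + coeff R w g)         ≈⟨ trans (coeff-∷ w y u _) (+-congˡ (coeff-∷ w x v g)) ⟨
    coeff R w ((y , u) ∷ (x , v) ∷ g)         ∎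
  coeff-↭ w (↭.trans p q)         = trans (coeff-↭ w p) (coeff-↭ w q)

  coeff-negate : ∀ w f → coeff R w (map (map₁ (-_)) f) ≈ - coeff R w f
  coeff-negate w []            = sym ε⁻¹≈ε
  coeff-negate w ((x , v) ∷ f) = begin
    coeff R w ((- x , v) ∷ map (map₁ (-_)) f)   ≈⟨ coeff-∷ w (- x) v _ ⟩
    δ (- x) v w + coeff R w (map (map₁ (-_)) f) ≈⟨ +-cong (δ-negate v) (coeff-negate w f) ⟩
    - δ x v w + - coeff R w f                 ≈⟨ ⁻¹-∙-comm _ _ ⟩
    - (δ x v w + coeff R w f)                 ≈⟨ -‿cong (coeff-∷ w x v f) ⟨
    - coeff R w ((x , v) ∷ f)                 ∎
    where
    δ-negate : ∀ v → δ (- x) v w ≈ - δ x v w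
    δ-negate v with v ≟W w
    ... | yes _ = refl
    ... | no  _ = sym ε⁻¹≈ε

  count : List Word → Word → Carrier
  count L w = coeff R w (map (1# ,_) L)

  count-++ : ∀ L M w → count (L ++ M) w ≈ count L w + count M w
  count-++ L M w =
    trans (reflexive (≡.cong (coeff R w) (map-++ (1# ,_) L M))) (coeff-++ w (map (1# ,_) L) (map (1# ,_) M))

  count-↭ : ∀ {L M} → L ↭ M → ∀ w → count L w ≈ count M w
  count-↭ p w = coeff-↭ w (↭.map⁺ (1# ,_) p)

  difference : List Word → List Word → FreeElt R
  difference L M = map (1# ,_) L ++ map (- 1# ,_) M

  coeff-difference : ∀ L M w → coeff R w (difference L M) ≈ count L w - count M w
  coeff-difference L M w =
    trans (coeff-++ w (map (1# ,_) L) (map (- 1# ,_) M))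
      (+-congˡ (trans (reflexive (≡.cong (coeff R w) (map-∘ M))) (coeff-negate w (map (1# ,_) M))))

  -- InIdeal R f is IdealCoeffs (λ w → coeff R w f).
  IdealCoeffs : (Word → Carrier) → Set (c ⊔ ℓ)
  IdealCoeffs κ = Σ (List (Carrier × Word × Word)) λ ts →
                    ∀ w → κ w ≈ coeff R w (concatMap (generatorTerm R) ts)

  IdealCoeffs-resp : ∀ {κ μ} → (∀ w → κ w ≈ μ w) → IdealCoeffs μ → IdealCoeffs κ
  IdealCoeffs-resp κ≈μ (ts , μ≈) = ts , λ w → trans (κ≈μ w) (μ≈ w)

  IdealCoeffs-0 : IdealCoeffs (λ _ → 0#)
  IdealCoeffs-0 = [] , λ _ → refl

  IdealCoeffs-+ : ∀ {κ μ} → IdealCoeffs κ → IdealCoeffs μ → IdealCoeffs (λ w → κ w + μ w)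
  IdealCoeffs-+ (ts , κ≈) (ss , μ≈) = ts ++ ss , λ w → begin
    _ + _                                                     ≈⟨ +-cong (κ≈ w) (μ≈ w) ⟩
    coeff R w (generators ts) + coeff R w (generators ss)     ≈⟨ coeff-++ w (generators ts) _ ⟨
    coeff R w (generators ts ++ generators ss)                ≡⟨ ≡.cong (coeff R w) (concatMap-++ (generatorTerm R) ts ss) ⟨
    coeff R w (generators (ts ++ ss))                         ∎
    where generators = concatMap (generatorTerm R)

  IdealCoeffs-neg : ∀ {κ} → IdealCoeffs κ → IdealCoeffs (λ w → - κ w)
  IdealCoeffs-neg (ts , κ≈) = map (map₁ (-_)) ts , λ w → begin
    - _                                                       ≈⟨ -‿cong (κ≈ w) ⟩
    - coeff R w (generators ts)                               ≈⟨ coeff-negate w (generators ts) ⟨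
    coeff R w (map (map₁ (-_)) (generators ts))               ≡⟨ ≡.cong (coeff R w) (generators-negate ts) ⟨
    coeff R w (generators (map (map₁ (-_)) ts))               ∎
    where
    generators = concatMap (generatorTerm R)
    generators-negate : ∀ ts → generators (map (map₁ (-_)) ts) ≡ map (map₁ (-_)) (generators ts)
    generators-negate []       = ≡.refl
    generators-negate (t ∷ ts) = ≡.trans (≡.cong (generatorTerm R (map₁ (-_) t) ++_) (generators-negate ts))
                                   (≡.sym (map-++ (map₁ (-_)) (generatorTerm R t) (generators ts)))

  ≋-sound : ∀ {L M} → L ≋ M → IdealCoeffs (λ w → count L w - count M w)
  ≋-sound (commute a b)                    =
    IdealCoeffs-resp (λ w → sym (coeff-difference [ a ++ D ∷ U ∷ b ] ((a ++ U ∷ D ∷ b) ∷ (a ++ b) ∷ []) w))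
      ([ (1# , a , b) ] , λ w → refl)
  ≋-sound (↭⇒≋ p)                          = IdealCoeffs-resp (λ w → x≈y⇒x∙y⁻¹≈ε (count-↭ p w)) IdealCoeffs-0
  ≋-sound {L} {M} (≋-sym p)                =
    IdealCoeffs-resp (λ w → sym (⁻¹-anti-homo‿- (count M w) (count L w))) (IdealCoeffs-neg (≋-sound p))
  ≋-sound {L} {N} (≋-trans {M = M} p q)    =
    IdealCoeffs-resp (λ w → sym (telescope (count L w) (count M w) (count N w)))
      (IdealCoeffs-+ (≋-sound p) (≋-sound q))
    where
    telescope : ∀ x y z → (x - y) + (y - z) ≈ x - z
    telescope x y z = begin
      (x - y) + (y - z)   ≈⟨ +-assoc x (- y) (y - z) ⟩
      x + (- y + (y - z)) ≈⟨ +-congˡ (+-assoc (- y) y (- z)) ⟨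
      x + ((- y + y) - z) ≈⟨ +-congˡ (+-congʳ (-‿inverseˡ y)) ⟩
      x + (0# - z)        ≈⟨ +-congˡ (+-identityˡ (- z)) ⟩
      x - z               ∎
  ≋-sound (≋-++ {L} {L′} {M} {M′} p q)     =
    IdealCoeffs-resp regroup (IdealCoeffs-+ (≋-sound p) (≋-sound q))
    where
    regroup : ∀ w → count (L ++ M) w - count (L′ ++ M′) w ≈ (count L w - count L′ w) + (count M w - count M′ w)
    regroup w = begin
      count (L ++ M) w - count (L′ ++ M′) w                      ≈⟨ +-cong (count-++ L M w) (-‿cong (count-++ L′ M′ w)) ⟩
      (count L w + count M w) - (count L′ w + count M′ w)        ≈⟨ +-congˡ (⁻¹-∙-comm _ _) ⟨
      (count L w + count M w) + (- count L′ w + - count M′ w)    ≈⟨ interchange _ _ _ _ ⟩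
      (count L w - count L′ w) + (count M w - count M′ w)        ∎

  ≋⇒weylEquiv : ∀ {u v} → [ u ] ≋ [ v ] → WeylEquiv R u v
  ≋⇒weylEquiv {u} {v} p = IdealCoeffs-resp (coeff-difference [ u ] [ v ]) (≋-sound p)

  RespectsWeyl : (Word → Carrier) → Set ℓ
  RespectsWeyl φ = ∀ a b → φ (a ++ D ∷ U ∷ b) ≈ φ (a ++ U ∷ D ∷ b) + φ (a ++ b)

  module Functional (φ : Word → Carrier) (φ-weyl : RespectsWeyl φ) where

    sumφ : List Word → Carrier
    sumφ L = foldr _+_ 0# (map φ L)

    sumφ-++ : ∀ L M → sumφ (L ++ M) ≈ sumφ L + sumφ M
    sumφ-++ []      M = sym (+-identityˡ _)
    sumφ-++ (w ∷ L) M = trans (+-congˡ (sumφ-++ L M)) (sym (+-assoc _ _ _))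

    ≋⇒sumφ≈ : ∀ {L M} → L ≋ M → sumφ L ≈ sumφ M
    ≋⇒sumφ≈ (commute a b)                = trans (+-identityʳ _) (trans (φ-weyl a b) (+-congˡ (sym (+-identityʳ _))))
    ≋⇒sumφ≈ (↭⇒≋ p)                      = foldr-commMonoid +-isCommutativeMonoid (↭⇒↭ₛ′ isEquivalence (↭.map⁺ φ p))
    ≋⇒sumφ≈ (≋-sym p)                    = sym (≋⇒sumφ≈ p)
    ≋⇒sumφ≈ (≋-trans p q)                = trans (≋⇒sumφ≈ p) (≋⇒sumφ≈ q)
    ≋⇒sumφ≈ (≋-++ {L} {L′} {M} {M′} p q) =
      trans (sumφ-++ L M) (trans (+-cong (≋⇒sumφ≈ p) (≋⇒sumφ≈ q)) (sym (sumφ-++ L′ M′)))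

    linear : FreeElt R → Carrier
    linear []            = 0#
    linear ((x , v) ∷ f) = x * φ v + linear f

    weigh : List Word → (Word → Carrier) → Carrier
    weigh []      κ = 0#
    weigh (w ∷ S) κ = κ w * φ w + weigh S κ

    weigh-cong : ∀ S {κ μ} → (∀ w → κ w ≈ μ w) → weigh S κ ≈ weigh S μ
    weigh-cong []      κ≈μ = refl
    weigh-cong (w ∷ S) κ≈μ = +-cong (*-congʳ (κ≈μ w)) (weigh-cong S κ≈μ)

    weigh-+ : ∀ S κ μ → weigh S (λ w → κ w + μ w) ≈ weigh S κ + weigh S μ
    weigh-+ []      κ μ = sym (+-identityˡ 0#)
    weigh-+ (w ∷ S) κ μ = trans (+-cong (distribʳ (φ w) (κ w) (μ w)) (weigh-+ S κ μ)) (interchange _ _ _ _)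

    weigh-δ-∉ : ∀ S x v → All (v ≢_) S → weigh S (δ x v) ≈ 0#
    weigh-δ-∉ []      x v []          = refl
    weigh-δ-∉ (w ∷ S) x v (v≢w ∷ v∉S) = trans (+-cong (trans (*-congʳ (δ-≢ v≢w)) (zeroˡ (φ w))) (weigh-δ-∉ S x v v∉S))
                                              (+-identityˡ 0#)
      where
      δ-≢ : v ≢ w → δ x v w ≈ 0#
      δ-≢ v≢w with v ≟W w
      ... | yes v≡w = contradiction v≡w v≢w
      ... | no  _   = refl

    weigh-δ : ∀ {S} x v → Unique S → v ∈ S → weigh S (δ x v) ≈ x * φ v
    weigh-δ {v ∷ S} x v (v∉S ∷ _) (here ≡.refl) =
      trans (+-cong (*-congʳ δ-refl) (weigh-δ-∉ S x v v∉S)) (+-identityʳ _)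
      where
      δ-refl : δ x v v ≈ x
      δ-refl with v ≟W v
      ... | yes _   = refl
      ... | no  v≢v = contradiction ≡.refl v≢v
    weigh-δ {w ∷ S} x v (w∉S ∷ uS) (there v∈S) =
      trans (+-cong (trans (*-congʳ δ-≢) (zeroˡ (φ w))) (weigh-δ x v uS v∈S)) (+-identityˡ _)
      where
      δ-≢ : δ x v w ≈ 0#
      δ-≢ with v ≟W w
      ... | yes ≡.refl = contradiction v∈S (All.All¬⇒¬Any w∉S)
      ... | no  _      = refl

    linear≈weigh : ∀ {S} → Unique S → ∀ f → All (λ t → proj₂ t ∈ S) f → linear f ≈ weigh S (λ w → coeff R w f)
    linear≈weigh {S} uS []            []          = sym (trans (weigh-cong S (λ _ → refl)) (zero-weigh S))
      where
      zero-weigh : ∀ S → weigh S (λ _ → 0#) ≈ 0#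
      zero-weigh []      = refl
      zero-weigh (w ∷ S) = trans (+-cong (zeroˡ (φ w)) (zero-weigh S)) (+-identityˡ 0#)
    linear≈weigh {S} uS ((x , v) ∷ f) (v∈S ∷ f⊆S) = begin
      x * φ v + linear f                                           ≈⟨ +-cong (sym (weigh-δ x v uS v∈S)) (linear≈weigh uS f f⊆S) ⟩
      weigh S (δ x v) + weigh S (λ w → coeff R w f)                ≈⟨ weigh-+ S (δ x v) _ ⟨
      weigh S (λ w → δ x v w + coeff R w f)                        ≈⟨ weigh-cong S (λ w → coeff-∷ w x v f) ⟨
      weigh S (λ w → coeff R w ((x , v) ∷ f))                      ∎

    -- Both sides are evaluated on a common duplicate-free list of the words occurring in f and g.
    linear-≈F : ∀ {f g} → _≈F_ R f g → linear f ≈ linear g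
    linear-≈F {f} {g} f≈g = begin
      linear f                         ≈⟨ linear≈weigh uS f (support⊆S (∈-++⁺ˡ ∘ ∈-map⁺ proj₂)) ⟩
      weigh S (λ w → coeff R w f)      ≈⟨ weigh-cong S f≈g ⟩
      weigh S (λ w → coeff R w g)      ≈⟨ linear≈weigh uS g (support⊆S (∈-++⁺ʳ (map proj₂ f) ∘ ∈-map⁺ proj₂)) ⟨
      linear g                         ∎
      where
      S = deduplicate _≟W_ (map proj₂ f ++ map proj₂ g)
      uS : Unique S
      uS = deduplicate-! _≟W_ _
      support⊆S : ∀ {h} → (∀ {t} → t ∈ h → proj₂ t ∈ map proj₂ f ++ map proj₂ g) → All (λ t → proj₂ t ∈ S) h
      support⊆S h⊆ = All.tabulate (λ t∈h → ∈-deduplicate⁺ _≟W_ (h⊆ t∈h))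

    linear-++ : ∀ f g → linear (f ++ g) ≈ linear f + linear g
    linear-++ []            g = sym (+-identityˡ _)
    linear-++ ((x , v) ∷ f) g = trans (+-congˡ (linear-++ f g)) (sym (+-assoc _ _ _))

    linear-generatorTerm : ∀ t → linear (generatorTerm R t) ≈ 0#
    linear-generatorTerm (x , a , b) = begin
      x * φ (a ++ D ∷ U ∷ b) + (- x * p + (- x * q + 0#))   ≈⟨ +-cong (*-congˡ (φ-weyl a b)) (+-congˡ (+-identityʳ _)) ⟩
      x * (p + q) + (- x * p + - x * q)                     ≈⟨ +-cong (distribˡ x p q) (+-cong (sym (-‿distribˡ-* x p)) (sym (-‿distribˡ-* x q))) ⟩
      (x * p + x * q) + (- (x * p) + - (x * q))             ≈⟨ +-congˡ (⁻¹-∙-comm (x * p) (x * q)) ⟩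
      (x * p + x * q) - (x * p + x * q)                     ≈⟨ -‿inverseʳ _ ⟩
      0#                                                    ∎
      where
      p = φ (a ++ U ∷ D ∷ b)
      q = φ (a ++ b)

    linear-generators : ∀ ts → linear (concatMap (generatorTerm R) ts) ≈ 0#
    linear-generators []       = refl
    linear-generators (t ∷ ts) =
      trans (linear-++ (generatorTerm R t) (concatMap (generatorTerm R) ts))
        (trans (+-cong (linear-generatorTerm t) (linear-generators ts)) (+-identityˡ 0#))

    weylEquiv⇒φ≈ : ∀ {u v} → WeylEquiv R u v → φ u ≈ φ v
    weylEquiv⇒φ≈ {u} {v} (ts , u-v≈) = x∙y⁻¹≈ε⇒x≈y (φ u) (φ v) (begin
      φ u - φ v                                         ≈⟨ +-cong (*-identityˡ (φ u)) (trans (sym (-‿distribˡ-* 1# (φ v))) (-‿cong (*-identityˡ (φ v)))) ⟨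
      1# * φ u + - 1# * φ v                             ≈⟨ +-congˡ (+-identityʳ _) ⟨
      linear ((1# , u) ∷ (- 1# , v) ∷ [])               ≈⟨ linear-≈F {(1# , u) ∷ (- 1# , v) ∷ []} {concatMap (generatorTerm R) ts} u-v≈ ⟩
      linear (concatMap (generatorTerm R) ts)           ≈⟨ linear-generators ts ⟩
      0#                                                ∎)


  shift : Carrier → Word → Carrier
  shift ζ []      = ζ
  shift ζ (U ∷ w) = 1# + shift ζ w
  shift ζ (D ∷ w) = - 1# + shift ζ w

  -- On the normal word Uᵃ Dᵇ this is the falling factorial ζ (ζ - 1) ⋯ (ζ - b + 1).
  eval : Carrier → Word → Carrier
  eval ζ []      = 1#
  eval ζ (U ∷ w) = eval ζ w
  eval ζ (D ∷ w) = shift ζ w * eval ζ w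

  shift-++ : ∀ ζ a b → shift ζ (a ++ b) ≡ shift (shift ζ b) a
  shift-++ ζ []      b = ≡.refl
  shift-++ ζ (U ∷ a) b = ≡.cong (1# +_) (shift-++ ζ a b)
  shift-++ ζ (D ∷ a) b = ≡.cong (- 1# +_) (shift-++ ζ a b)

  shift-cong : ∀ {ζ ζ′} w → ζ ≈ ζ′ → shift ζ w ≈ shift ζ′ w
  shift-cong []      ζ≈ζ′ = ζ≈ζ′
  shift-cong (U ∷ w) ζ≈ζ′ = +-congˡ (shift-cong w ζ≈ζ′)
  shift-cong (D ∷ w) ζ≈ζ′ = +-congˡ (shift-cong w ζ≈ζ′)

  eval-cong : ∀ {ζ ζ′} w → ζ ≈ ζ′ → eval ζ w ≈ eval ζ′ w
  eval-cong []      ζ≈ζ′ = refl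
  eval-cong (U ∷ w) ζ≈ζ′ = eval-cong w ζ≈ζ′
  eval-cong (D ∷ w) ζ≈ζ′ = *-cong (shift-cong w ζ≈ζ′) (eval-cong w ζ≈ζ′)

  eval-++ : ∀ ζ a b → eval ζ (a ++ b) ≈ eval (shift ζ b) a * eval ζ b
  eval-++ ζ []      b = sym (*-identityˡ _)
  eval-++ ζ (U ∷ a) b = eval-++ ζ a b
  eval-++ ζ (D ∷ a) b = begin
    shift ζ (a ++ b) * eval ζ (a ++ b)                     ≈⟨ *-cong (reflexive (shift-++ ζ a b)) (eval-++ ζ a b) ⟩
    shift (shift ζ b) a * (eval (shift ζ b) a * eval ζ b)  ≈⟨ *-assoc _ _ _ ⟨
    eval (shift ζ b) (D ∷ a) * eval ζ b                    ∎

  -1+[1+x]≈x : ∀ x → - 1# + (1# + x) ≈ x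
  -1+[1+x]≈x x = trans (sym (+-assoc _ _ _)) (trans (+-congʳ (-‿inverseˡ 1#)) (+-identityˡ x))

  1+[-1+x]≈x : ∀ x → 1# + (- 1# + x) ≈ x
  1+[-1+x]≈x x = trans (sym (+-assoc _ _ _)) (trans (+-congʳ (-‿inverseʳ 1#)) (+-identityˡ x))

  eval-weyl : ∀ ζ → RespectsWeyl (eval ζ)
  eval-weyl ζ a b = begin
    eval ζ (a ++ D ∷ U ∷ b)                          ≈⟨ eval-++ ζ a (D ∷ U ∷ b) ⟩
    eval (- 1# + (1# + t)) a * ((1# + t) * e)        ≈⟨ *-cong (eval-cong a (-1+[1+x]≈x t)) (distribʳ e 1# t) ⟩
    eval t a * (1# * e + t * e)                      ≈⟨ distribˡ (eval t a) (1# * e) (t * e) ⟩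
    eval t a * (1# * e) + eval t a * (t * e)         ≈⟨ +-comm _ _ ⟩
    eval t a * (t * e) + eval t a * (1# * e)         ≈⟨ +-cong (*-congʳ (eval-cong a (1+[-1+x]≈x t))) (*-congˡ (sym (*-identityˡ e))) ⟨
    eval (1# + (- 1# + t)) a * (t * e) + eval t a * e ≈⟨ +-cong (eval-++ ζ a (U ∷ D ∷ b)) (eval-++ ζ a b) ⟨
    eval ζ (a ++ U ∷ D ∷ b) + eval ζ (a ++ b)        ∎
    where
    t = shift ζ b
    e = eval ζ b

  natCast-+ : ∀ m n → natCast R (m ℕ.+ n) ≈ natCast R m + natCast R n
  natCast-+ zero    n = sym (+-identityˡ _)
  natCast-+ (suc m) n = trans (+-congˡ (natCast-+ m n)) (sym (+-assoc _ _ _))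

  natCast-* : ∀ m n → natCast R (m ℕ.* n) ≈ natCast R m * natCast R n
  natCast-* zero    n = sym (zeroˡ _)
  natCast-* (suc m) n = begin
    natCast R (n ℕ.+ m ℕ.* n)                 ≈⟨ natCast-+ n (m ℕ.* n) ⟩
    natCast R n + natCast R (m ℕ.* n)         ≈⟨ +-cong (sym (*-identityˡ _)) (natCast-* m n) ⟩
    1# * natCast R n + natCast R m * natCast R n ≈⟨ distribʳ _ _ _ ⟨
    natCast R (suc m) * natCast R n           ∎

  eval-Us : ∀ ζ a → eval ζ (replicate a U) ≈ 1#
  eval-Us ζ zero    = refl
  eval-Us ζ (suc a) = eval-Us ζ a

  -- The last letter D contributes the first factor ζ of the falling factorial.
  eval-Ds : ∀ N b → eval (natCast R N) (replicate b D) ≈ natCast R (fall N b)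
  eval-Ds N       zero    = sym (+-identityʳ 1#)
  eval-Ds N       (suc b) = begin
    eval (natCast R N) (replicate (suc b) D)                            ≡⟨ ≡.cong (eval _) (replicate-∷ʳ b) ⟩
    eval (natCast R N) (replicate b D ++ [ D ])                         ≈⟨ eval-++ _ (replicate b D) [ D ] ⟩
    eval (- 1# + natCast R N) (replicate b D) * (natCast R N * 1#)      ≈⟨ *-congˡ (*-identityʳ _) ⟩
    eval (- 1# + natCast R N) (replicate b D) * natCast R N             ≈⟨ last-factor N ⟩
    natCast R (fall N (suc b))                                          ∎
    where
    replicate-∷ʳ : ∀ n → replicate (suc n) D ≡ replicate n D ++ [ D ]
    replicate-∷ʳ zero    = ≡.refl
    replicate-∷ʳ (suc n) = ≡.cong (D ∷_) (replicate-∷ʳ n)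
    last-factor : ∀ N → eval (- 1# + natCast R N) (replicate b D) * natCast R N ≈ natCast R (fall N (suc b))
    last-factor zero    = zeroʳ _
    last-factor (suc N) = begin
      eval (- 1# + (1# + natCast R N)) (replicate b D) * natCast R (suc N) ≈⟨ *-congʳ (eval-cong (replicate b D) (-1+[1+x]≈x _)) ⟩
      eval (natCast R N) (replicate b D) * natCast R (suc N)              ≈⟨ *-congʳ (eval-Ds N b) ⟩
      natCast R (fall N b) * natCast R (suc N)                            ≈⟨ *-comm _ _ ⟩
      natCast R (suc N) * natCast R (fall N b)                            ≈⟨ natCast-* (suc N) (fall N b) ⟨
      natCast R (fall (suc N) (suc b))                                    ∎

  eval-normalWord : ∀ N p → eval (natCast R N) (normalWord p) ≈ natCast R (fall N (proj₂ p))
  eval-normalWord N (a , b) = begin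
    eval (natCast R N) (replicate a U ++ replicate b D)                              ≈⟨ eval-++ _ (replicate a U) _ ⟩
    eval (shift (natCast R N) (replicate b D)) (replicate a U) * eval (natCast R N) (replicate b D)
                                                                                     ≈⟨ *-cong (eval-Us _ a) (eval-Ds N b) ⟩
    1# * natCast R (fall N b)                                                        ≈⟨ *-identityˡ _ ⟩
    natCast R (fall N b)                                                             ∎

  module _ (N : ℕ) where
    open Functional (eval (natCast R N)) (eval-weyl (natCast R N)) public

    sumφ-normalWords : ∀ L → sumφ (map normalWord L) ≈ natCast R (fallSum N (map proj₂ L))
    sumφ-normalWords []      = refl
    sumφ-normalWords (p ∷ L) =
      trans (+-cong (eval-normalWord N p) (sumφ-normalWords L)) (sym (natCast-+ (fall N (proj₂ p)) _))

  downHeights-↭⇒weylEquiv : ∀ {u v} → height u ≡ height v → downHeights u ↭ downHeights v → WeylEquiv R u v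
  downHeights-↭⇒weylEquiv {u} {v} hu≡hv p = ≋⇒weylEquiv
    (≋-trans (≋-normalOrder u)
      (≋-trans (↭⇒≋ (↭.map⁺ normalWord (downHeights-↭⇒normalOrder-↭ {u} {v} hu≡hv p))) (≋-sym (≋-normalOrder v))))

module Characteristic0 {c ℓ : Level} (R : CommutativeRing c ℓ) (F : IsFieldChar0 R) where
  open CommutativeRing R
  open import Relation.Binary.Reasoning.Setoid setoid
  open import Algebra.Properties.Group +-group using (∙-cancelˡ)
  open IsFieldChar0 F using (char0)
  open WeylAlgebra R

  natCast-injective : ∀ m n → natCast R m ≈ natCast R n → m ≡ n
  natCast-injective zero    zero    _  = ≡.refl
  natCast-injective zero    (suc n) eq = ⊥-elim (char0 n (sym eq))
  natCast-injective (suc m) zero    eq = ⊥-elim (char0 m eq)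
  natCast-injective (suc m) (suc n) eq = ≡.cong suc (natCast-injective m n (∙-cancelˡ 1# _ _ eq))

  weylEquiv⇒downHeights-↭ : ∀ {u v} → WeylEquiv R u v → downHeights u ↭ downHeights v
  weylEquiv⇒downHeights-↭ {u} {v} u~v = fallSum≡⇒downHeights-↭ {u} {v} λ N → natCast-injective _ _ (begin
    natCast R (fallSum N (normalDExps u))        ≈⟨ sumφ-normalWords N (normalOrder u) ⟨
    sumφ N (map normalWord (normalOrder u))      ≈⟨ ≋⇒sumφ≈ N (≋-normalOrder u) ⟨
    eval (natCast R N) u + 0#                    ≈⟨ +-congʳ (weylEquiv⇒φ≈ N {u} {v} u~v) ⟩
    eval (natCast R N) v + 0#                    ≈⟨ ≋⇒sumφ≈ N (≋-normalOrder v) ⟩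
    sumφ N (map normalWord (normalOrder v))      ≈⟨ sumφ-normalWords N (normalOrder v) ⟩
    natCast R (fallSum N (normalDExps v))        ∎)

module Zippers where
  open import Data.Nat using (_≤_; _<_)
  open import Data.Integer using (+_; -[1+_]; _+_; _-_)
  open import Data.Integer.Tactic.RingSolver using (solve-∀)
  open import Algebra.Properties.AbelianGroup ℤ.+-0-abelianGroup using (identityʳ-unique)
  open ≡ using (refl; cong; cong₂; sym; trans)

  Zipper : Set
  Zipper = List ℕ × List ℕ

  at : List ℕ → ℕ → ℕ
  at []      i       = 0
  at (d ∷ B) zero    = d
  at (d ∷ B) (suc i) = at B i

  -- Reading a word from right to left, a zipper (B , A) at the current height e records how many
  -- letters D were read at the heights e, e - 1, … (in B) and e + 1, e + 2, … (in A).
  step : Letter → Zipper → Zipper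
  step D (B , A) = drop 1 B , suc (at B 0) ∷ A
  step U (B , A) = at A 0 ∷ B , drop 1 A

  run : Word → Zipper → Zipper
  run []      z = z
  run (x ∷ w) z = step x (run w z)

  zipper : Word → Zipper
  zipper w = run w ([] , [])

  run-++ : ∀ a b z → run (a ++ b) z ≡ run a (run b z)
  run-++ []      b z = refl
  run-++ (x ∷ a) b z = cong (step x) (run-++ a b z)

  descending : ℤ → List ℕ → List ℤ
  descending e []      = []
  descending e (d ∷ B) = replicate d e ++ descending (-1ℤ + e) B

  ascending : ℤ → List ℕ → List ℤ
  ascending e []      = []
  ascending e (d ∷ A) = replicate d e ++ ascending (1ℤ + e) A

  heightsAt : ℤ → Zipper → List ℤ
  heightsAt e (B , A) = descending e B ++ ascending (1ℤ + e) A

  descending-head : ∀ e B → descending e B ≡ replicate (at B 0) e ++ descending (-1ℤ + e) (drop 1 B)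
  descending-head e []      = refl
  descending-head e (d ∷ B) = refl

  ascending-head : ∀ e A → ascending e A ≡ replicate (at A 0) e ++ ascending (1ℤ + e) (drop 1 A)
  ascending-head e []      = refl
  ascending-head e (d ∷ A) = refl

  heightsAt-U : ∀ e z → heightsAt e z ↭ heightsAt (1ℤ + e) (step U z)
  heightsAt-U e (B , A) = begin
    descending e B ++ ascending (1ℤ + e) A
      ≡⟨ cong (descending e B ++_) (ascending-head (1ℤ + e) A) ⟩
    descending e B ++ replicate (at A 0) (1ℤ + e) ++ ascending (1ℤ + (1ℤ + e)) (drop 1 A)
      ↭⟨ ↭.shifts (descending e B) (replicate (at A 0) (1ℤ + e)) ⟩
    replicate (at A 0) (1ℤ + e) ++ descending e B ++ ascending (1ℤ + (1ℤ + e)) (drop 1 A)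
      ≡⟨ cong (λ e′ → replicate (at A 0) (1ℤ + e) ++ descending e′ B ++ ascending (1ℤ + (1ℤ + e)) (drop 1 A))
              (sym (ℤ.pred-suc e)) ⟩
    replicate (at A 0) (1ℤ + e) ++ descending (-1ℤ + (1ℤ + e)) B ++ ascending (1ℤ + (1ℤ + e)) (drop 1 A)
      ≡⟨ ++-assoc (replicate (at A 0) (1ℤ + e)) _ _ ⟨
    heightsAt (1ℤ + e) (step U (B , A))
      ∎
    where open PermutationReasoning

  heightsAt-D : ∀ e z → e ∷ heightsAt e z ↭ heightsAt (-1ℤ + e) (step D z)
  heightsAt-D e (B , A) = begin
    e ∷ descending e B ++ ascending (1ℤ + e) A
      ≡⟨ cong (λ xs → e ∷ xs ++ ascending (1ℤ + e) A) (descending-head e B) ⟩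
    e ∷ (replicate (at B 0) e ++ descending (-1ℤ + e) (drop 1 B)) ++ ascending (1ℤ + e) A
      ≡⟨ cong (e ∷_) (++-assoc (replicate (at B 0) e) _ _) ⟩
    (e ∷ replicate (at B 0) e) ++ descending (-1ℤ + e) (drop 1 B) ++ ascending (1ℤ + e) A
      ↭⟨ ↭.shifts (e ∷ replicate (at B 0) e) (descending (-1ℤ + e) (drop 1 B)) ⟩
    descending (-1ℤ + e) (drop 1 B) ++ (e ∷ replicate (at B 0) e) ++ ascending (1ℤ + e) A
      ≡⟨ cong (λ e′ → descending (-1ℤ + e) (drop 1 B) ++ (e′ ∷ replicate (at B 0) e′) ++ ascending (1ℤ + e′) A)
              (sym (ℤ.suc-pred e)) ⟩
    heightsAt (-1ℤ + e) (step D (B , A))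
      ∎
    where open PermutationReasoning

  downHeights-zipper : ∀ w → downHeights w ↭ heightsAt (height w) (zipper w)
  downHeights-zipper []      = ↭-refl
  downHeights-zipper (U ∷ w) = ↭-trans (downHeights-zipper w) (heightsAt-U (height w) (zipper w))
  downHeights-zipper (D ∷ w) = ↭-trans (prep (height w) (downHeights-zipper w)) (heightsAt-D (height w) (zipper w))

  multiplicity : ℤ → List ℤ → ℕ
  multiplicity x L = length (filter (x ℤ.≟_) L)

  multiplicity-↭ : ∀ x {L M} → L ↭ M → multiplicity x L ≡ multiplicity x M
  multiplicity-↭ x p = ↭.↭-length (↭.filter-↭ (x ℤ.≟_) p)

  multiplicity-++ : ∀ x L M → multiplicity x (L ++ M) ≡ multiplicity x L ℕ.+ multiplicity x M
  multiplicity-++ x L M = trans (cong length (filter-++ (x ℤ.≟_) L M)) (length-++ (filter (x ℤ.≟_) L))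

  multiplicity-replicate-≡ : ∀ x d → multiplicity x (replicate d x) ≡ d
  multiplicity-replicate-≡ x d = trans (cong length (filter-all (x ℤ.≟_) (All.replicate⁺ d refl))) (length-replicate d)

  multiplicity-replicate-≢ : ∀ {x y} d → x ≢ y → multiplicity x (replicate d y) ≡ 0
  multiplicity-replicate-≢ d x≢y = cong length (filter-none (_ ℤ.≟_) (All.replicate⁺ d x≢y))

  private
    shifted≢ : ∀ e {x} → x ≢ 0ℤ → e + x ≢ e
    shifted≢ e x≢0 e+x≡e = x≢0 (identityʳ-unique e _ e+x≡e)

  multiplicity-descending-above : ∀ e B j → multiplicity (e + + suc j) (descending e B) ≡ 0
  multiplicity-descending-above e []      j = refl
  multiplicity-descending-above e (d ∷ B) j = begin
    multiplicity (e + + suc j) (replicate d e ++ descending (-1ℤ + e) B)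
      ≡⟨ multiplicity-++ _ (replicate d e) _ ⟩
    multiplicity (e + + suc j) (replicate d e) ℕ.+ multiplicity (e + + suc j) (descending (-1ℤ + e) B)
      ≡⟨ cong₂ ℕ._+_ (multiplicity-replicate-≢ d (shifted≢ e λ ()))
                     (cong (λ x → multiplicity x (descending (-1ℤ + e) B)) (lemma e (+ j))) ⟩
    multiplicity ((-1ℤ + e) + + suc (suc j)) (descending (-1ℤ + e) B)
      ≡⟨ multiplicity-descending-above (-1ℤ + e) B (suc j) ⟩
    0 ∎
    where
    open ≡.≡-Reasoning
    lemma : ∀ e j → e + (1ℤ + j) ≡ (-1ℤ + e) + (1ℤ + (1ℤ + j))
    lemma = solve-∀

  multiplicity-descending : ∀ e B i → multiplicity (e - + i) (descending e B) ≡ at B i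
  multiplicity-descending e []      i       = refl
  multiplicity-descending e (d ∷ B) zero    = begin
    multiplicity (e - 0ℤ) (replicate d e ++ descending (-1ℤ + e) B)
      ≡⟨ cong (λ x → multiplicity x (replicate d e ++ descending (-1ℤ + e) B)) (ℤ.+-identityʳ e) ⟩
    multiplicity e (replicate d e ++ descending (-1ℤ + e) B)
      ≡⟨ multiplicity-++ e (replicate d e) _ ⟩
    multiplicity e (replicate d e) ℕ.+ multiplicity e (descending (-1ℤ + e) B)
      ≡⟨ cong₂ ℕ._+_ (multiplicity-replicate-≡ e d)
                     (trans (cong (λ x → multiplicity x (descending (-1ℤ + e) B)) (lemma e))
                            (multiplicity-descending-above (-1ℤ + e) B 0)) ⟩
    d ℕ.+ 0 ≡⟨ ℕ.+-identityʳ d ⟩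
    d ∎
    where
    open ≡.≡-Reasoning
    lemma : ∀ e → e ≡ (-1ℤ + e) + 1ℤ
    lemma = solve-∀
  multiplicity-descending e (d ∷ B) (suc i) = begin
    multiplicity (e - + suc i) (replicate d e ++ descending (-1ℤ + e) B)
      ≡⟨ multiplicity-++ _ (replicate d e) _ ⟩
    multiplicity (e - + suc i) (replicate d e) ℕ.+ multiplicity (e - + suc i) (descending (-1ℤ + e) B)
      ≡⟨ cong₂ ℕ._+_ (multiplicity-replicate-≢ d (shifted≢ e λ ()))
                     (cong (λ x → multiplicity x (descending (-1ℤ + e) B)) (lemma e (+ i))) ⟩
    multiplicity ((-1ℤ + e) - + i) (descending (-1ℤ + e) B)
      ≡⟨ multiplicity-descending (-1ℤ + e) B i ⟩
    at B i ∎
    where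
    open ≡.≡-Reasoning
    lemma : ∀ e i → e - (1ℤ + i) ≡ (-1ℤ + e) - i
    lemma = solve-∀

  multiplicity-ascending-below : ∀ e A i → multiplicity (e - + suc i) (ascending e A) ≡ 0
  multiplicity-ascending-below e []      i = refl
  multiplicity-ascending-below e (d ∷ A) i = begin
    multiplicity (e - + suc i) (replicate d e ++ ascending (1ℤ + e) A)
      ≡⟨ multiplicity-++ _ (replicate d e) _ ⟩
    multiplicity (e - + suc i) (replicate d e) ℕ.+ multiplicity (e - + suc i) (ascending (1ℤ + e) A)
      ≡⟨ cong₂ ℕ._+_ (multiplicity-replicate-≢ d (shifted≢ e λ ()))
                     (cong (λ x → multiplicity x (ascending (1ℤ + e) A)) (lemma e (+ i))) ⟩
    multiplicity ((1ℤ + e) - + suc (suc i)) (ascending (1ℤ + e) A)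
      ≡⟨ multiplicity-ascending-below (1ℤ + e) A (suc i) ⟩
    0 ∎
    where
    open ≡.≡-Reasoning
    lemma : ∀ e i → e - (1ℤ + i) ≡ (1ℤ + e) - (1ℤ + (1ℤ + i))
    lemma = solve-∀

  multiplicity-ascending : ∀ e A j → multiplicity (e + + j) (ascending e A) ≡ at A j
  multiplicity-ascending e []      j       = refl
  multiplicity-ascending e (d ∷ A) zero    = begin
    multiplicity (e + 0ℤ) (replicate d e ++ ascending (1ℤ + e) A)
      ≡⟨ cong (λ x → multiplicity x (replicate d e ++ ascending (1ℤ + e) A)) (ℤ.+-identityʳ e) ⟩
    multiplicity e (replicate d e ++ ascending (1ℤ + e) A)
      ≡⟨ multiplicity-++ e (replicate d e) _ ⟩
    multiplicity e (replicate d e) ℕ.+ multiplicity e (ascending (1ℤ + e) A)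
      ≡⟨ cong₂ ℕ._+_ (multiplicity-replicate-≡ e d)
                     (trans (cong (λ x → multiplicity x (ascending (1ℤ + e) A)) (lemma e))
                            (multiplicity-ascending-below (1ℤ + e) A 0)) ⟩
    d ℕ.+ 0 ≡⟨ ℕ.+-identityʳ d ⟩
    d ∎
    where
    open ≡.≡-Reasoning
    lemma : ∀ e → e ≡ (1ℤ + e) - 1ℤ
    lemma = solve-∀
  multiplicity-ascending e (d ∷ A) (suc j) = begin
    multiplicity (e + + suc j) (replicate d e ++ ascending (1ℤ + e) A)
      ≡⟨ multiplicity-++ _ (replicate d e) _ ⟩
    multiplicity (e + + suc j) (replicate d e) ℕ.+ multiplicity (e + + suc j) (ascending (1ℤ + e) A)
      ≡⟨ cong₂ ℕ._+_ (multiplicity-replicate-≢ d (shifted≢ e λ ()))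
                     (cong (λ x → multiplicity x (ascending (1ℤ + e) A)) (lemma e (+ j))) ⟩
    multiplicity ((1ℤ + e) + + j) (ascending (1ℤ + e) A)
      ≡⟨ multiplicity-ascending (1ℤ + e) A j ⟩
    at A j ∎
    where
    open ≡.≡-Reasoning
    lemma : ∀ e j → e + (1ℤ + j) ≡ (1ℤ + e) + j
    lemma = solve-∀

  multiplicity-heightsAt-below : ∀ e B A i → multiplicity (e - + i) (heightsAt e (B , A)) ≡ at B i
  multiplicity-heightsAt-below e B A i = begin
    multiplicity (e - + i) (descending e B ++ ascending (1ℤ + e) A)
      ≡⟨ multiplicity-++ _ (descending e B) _ ⟩
    multiplicity (e - + i) (descending e B) ℕ.+ multiplicity (e - + i) (ascending (1ℤ + e) A)
      ≡⟨ cong₂ ℕ._+_ (multiplicity-descending e B i)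
                     (trans (cong (λ x → multiplicity x (ascending (1ℤ + e) A)) (lemma e (+ i)))
                            (multiplicity-ascending-below (1ℤ + e) A i)) ⟩
    at B i ℕ.+ 0 ≡⟨ ℕ.+-identityʳ _ ⟩
    at B i ∎
    where
    open ≡.≡-Reasoning
    lemma : ∀ e i → e - i ≡ (1ℤ + e) - (1ℤ + i)
    lemma = solve-∀

  multiplicity-heightsAt-above : ∀ e B A j → multiplicity ((1ℤ + e) + + j) (heightsAt e (B , A)) ≡ at A j
  multiplicity-heightsAt-above e B A j = begin
    multiplicity ((1ℤ + e) + + j) (descending e B ++ ascending (1ℤ + e) A)
      ≡⟨ multiplicity-++ _ (descending e B) _ ⟩
    multiplicity ((1ℤ + e) + + j) (descending e B) ℕ.+ multiplicity ((1ℤ + e) + + j) (ascending (1ℤ + e) A)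
      ≡⟨ cong₂ ℕ._+_ (trans (cong (λ x → multiplicity x (descending e B)) (lemma e (+ j)))
                            (multiplicity-descending-above e B j))
                     (multiplicity-ascending (1ℤ + e) A j) ⟩
    at A j ∎
    where
    open ≡.≡-Reasoning
    lemma : ∀ e j → (1ℤ + e) + j ≡ e + (1ℤ + j)
    lemma = solve-∀

  -- At a final height k ≥ 0 the first k entries of B (heights k, …, 1) may vanish, as the path
  -- crosses these levels upwards anyway; every other entry is positive, and the lists stop where
  -- the range of visited heights ends.
  Valid : ℤ → Zipper → Set
  Valid (+ k)    (B , A) = k ≤ length B × All (0 <_) (drop k B) × All (0 <_) A
  Valid -[1+ k ] (B , A) = All (0 <_) B × All (0 <_) A × suc k ≤ length A

  valid-U : ∀ h z → Valid h z → Valid (1ℤ + h) (step U z)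
  valid-U (+ k)          (B , A)     (k≤ , B⁺ , A⁺)          = s≤s k≤ , B⁺ , All.drop⁺ 1 A⁺
  valid-U -[1+ zero ]    (B , a ∷ A) (B⁺ , a⁺ ∷ A⁺ , _)      = z≤n , a⁺ ∷ B⁺ , A⁺
  valid-U -[1+ suc k ]   (B , a ∷ A) (B⁺ , a⁺ ∷ A⁺ , s≤s k<) = a⁺ ∷ B⁺ , A⁺ , k<

  valid-D : ∀ h z → Valid h z → Valid (-1ℤ + h) (step D z)
  valid-D (+ zero)  (B , A)     (_ , B⁺ , A⁺)     = All.drop⁺ 1 B⁺ , s≤s z≤n ∷ A⁺ , s≤s z≤n
  valid-D (+ suc k) (b ∷ B , A) (s≤s k≤ , B⁺ , A⁺) = k≤ , B⁺ , s≤s z≤n ∷ A⁺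
  valid-D -[1+ k ]  (B , A)     (B⁺ , A⁺ , k<)    = All.drop⁺ 1 B⁺ , s≤s z≤n ∷ A⁺ , s≤s k<

  valid-zipper : ∀ w → Valid (height w) (zipper w)
  valid-zipper []      = z≤n , [] , []
  valid-zipper (U ∷ w) = valid-U (height w) (zipper w) (valid-zipper w)
  valid-zipper (D ∷ w) = valid-D (height w) (zipper w) (valid-zipper w)

  below-agree : ∀ e B A B′ A′ → heightsAt e (B , A) ↭ heightsAt e (B′ , A′) → ∀ i → at B i ≡ at B′ i
  below-agree e B A B′ A′ p i =
    trans (sym (multiplicity-heightsAt-below e B A i))
      (trans (multiplicity-↭ _ p) (multiplicity-heightsAt-below e B′ A′ i))

  above-agree : ∀ e B A B′ A′ → heightsAt e (B , A) ↭ heightsAt e (B′ , A′) → ∀ j → at A j ≡ at A′ j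
  above-agree e B A B′ A′ p j =
    trans (sym (multiplicity-heightsAt-above e B A j))
      (trans (multiplicity-↭ _ p) (multiplicity-heightsAt-above e B′ A′ j))

  at-injective : ∀ k {X Y} → k ≤ length X → k ≤ length Y → All (0 <_) (drop k X) → All (0 <_) (drop k Y) →
                 (∀ i → at X i ≡ at Y i) → X ≡ Y
  at-injective zero    {[]}    {[]}    _       _       _          _          _  = refl
  at-injective zero    {[]}    {y ∷ Y} _       _       _          (y⁺ ∷ _)   eq = contradiction (eq 0) (ℕ.<⇒≢ y⁺)
  at-injective zero    {x ∷ X} {[]}    _       _       (x⁺ ∷ _)   _          eq = contradiction (sym (eq 0)) (ℕ.<⇒≢ x⁺)
  at-injective zero    {x ∷ X} {y ∷ Y} _       _       (_ ∷ X⁺)   (_ ∷ Y⁺)   eq =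
    cong₂ _∷_ (eq 0) (at-injective zero z≤n z≤n X⁺ Y⁺ (eq ∘ suc))
  at-injective (suc k) {x ∷ X} {y ∷ Y} (s≤s kX) (s≤s kY) X⁺     Y⁺         eq =
    cong₂ _∷_ (eq 0) (at-injective k kX kY X⁺ Y⁺ (eq ∘ suc))

  heightsAt-injective : ∀ h {z z′} → Valid h z → Valid h z′ → heightsAt h z ↭ heightsAt h z′ → z ≡ z′
  heightsAt-injective h@(+ k) {B , A} {B′ , A′} (kB , B⁺ , A⁺) (kB′ , B′⁺ , A′⁺) p =
    cong₂ _,_ (at-injective k kB kB′ B⁺ B′⁺ (below-agree h B A B′ A′ p))
              (at-injective 0 z≤n z≤n A⁺ A′⁺ (above-agree h B A B′ A′ p))
  heightsAt-injective h@(-[1+ k ]) {B , A} {B′ , A′} (B⁺ , A⁺ , _) (B′⁺ , A′⁺ , _) p =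
    cong₂ _,_ (at-injective 0 z≤n z≤n B⁺ B′⁺ (below-agree h B A B′ A′ p))
              (at-injective 0 z≤n z≤n A⁺ A′⁺ (above-agree h B A B′ A′ p))

open Zippers

module Shapes where
  open import Data.Nat using (_≤_; _<_)
  open import Data.Integer using (+_; -[1+_]; _+_; _-_; -_)
  open import Data.Integer.Tactic.RingSolver using (solve-∀)
  open import Data.Nat.Tactic.RingSolver renaming (solve-∀ to ℕ-solve-∀)
  open import Algebra.Properties.AbelianGroup ℤ.+-0-abelianGroup using (∙-cancelʳ)
  open ≡ using (refl; cong; cong₂; sym; trans; subst; subst₂)

  -- The heights 0 and h of the ends of a word split its range of heights into the middle part
  -- between them and the parts below and above it.  A shape records, height by height, how many
  -- letters D sit there, less one except in the middle part of a rising word (h ≥ 0).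
  data Middle : Set where
    rising  : List ℕ → Middle
    falling : ℕ → List ℕ → Middle

  Shape : Set
  Shape = (List ℕ × List ℕ) × Middle

  UDs : ℕ → Word
  UDs zero    = []
  UDs (suc c) = U ∷ D ∷ UDs c

  DUs : ℕ → Word
  DUs zero    = []
  DUs (suc c) = D ∷ U ∷ DUs c

  belowWord : List ℕ → Word
  belowWord []      = []
  belowWord (c ∷ L) = UDs c ++ U ∷ belowWord L ++ [ D ]

  aboveWord : List ℕ → Word
  aboveWord []      = []
  aboveWord (c ∷ R) = DUs c ++ D ∷ aboveWord R ++ [ U ]

  risingWord : List ℕ → Word
  risingWord []      = []
  risingWord (d ∷ M) = U ∷ DUs d ++ risingWord M

  fallingWord : List ℕ → Word
  fallingWord []      = []
  fallingWord (c ∷ M) = D ∷ UDs c ++ fallingWord M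

  representative : Shape → Word
  representative ((L , R) , rising M)    = aboveWord R ++ risingWord M ++ belowWord L
  representative ((L , R) , falling m M) = belowWord L ++ fallingWord (m ∷ M) ++ aboveWord R

  shapeHeight : Shape → ℤ
  shapeHeight (_ , rising M)    = + length M
  shapeHeight (_ , falling m M) = -[1+ length M ]

  shapeZipper : Shape → Zipper
  shapeZipper ((L , R) , rising M)    = M ++ map suc L , map suc R
  shapeZipper ((L , R) , falling m M) = map suc L , map suc (m ∷ M) ++ map suc R

  run-UDs : ∀ c x B A → run (UDs c) (x ∷ B , A) ≡ (c ℕ.+ x ∷ B , A)
  run-UDs zero    x B A = refl
  run-UDs (suc c) x B A = cong (step U ∘ step D) (run-UDs c x B A)

  run-DUs : ∀ c x B A → run (DUs c) (B , x ∷ A) ≡ (B , c ℕ.+ x ∷ A)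
  run-DUs zero    x B A = refl
  run-DUs (suc c) x B A = cong (step D ∘ step U) (run-DUs c x B A)

  run-U∷DUs : ∀ d B → run (U ∷ DUs d) (B , []) ≡ (d ∷ B , [])
  run-U∷DUs zero    B = refl
  run-U∷DUs (suc d) B = cong (step U ∘ step D) (run-U∷DUs d B)

  run-D∷UDs : ∀ c A → run (D ∷ UDs c) ([] , A) ≡ ([] , suc c ∷ A)
  run-D∷UDs zero    A = refl
  run-D∷UDs (suc c) A = cong (step D ∘ step U) (run-D∷UDs c A)

  run-belowWord : ∀ L A → run (belowWord L) ([] , A) ≡ (map suc L , A)
  run-belowWord []      A = refl
  run-belowWord (c ∷ L) A = begin
    run (UDs c ++ U ∷ belowWord L ++ [ D ]) ([] , A)          ≡⟨ run-++ (UDs c) (U ∷ belowWord L ++ [ D ]) _ ⟩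
    run (UDs c) (step U (run (belowWord L ++ [ D ]) ([] , A))) ≡⟨ cong (run (UDs c) ∘ step U) (run-++ (belowWord L) [ D ] _) ⟩
    run (UDs c) (step U (run (belowWord L) ([] , 1 ∷ A)))      ≡⟨ cong (run (UDs c) ∘ step U) (run-belowWord L (1 ∷ A)) ⟩
    run (UDs c) (1 ∷ map suc L , A)                            ≡⟨ run-UDs c 1 (map suc L) A ⟩
    (c ℕ.+ 1 ∷ map suc L , A)                                  ≡⟨ cong (λ c′ → c′ ∷ map suc L , A) (ℕ.+-comm c 1) ⟩
    (suc c ∷ map suc L , A)                                    ∎
    where open ≡.≡-Reasoning

  run-aboveWord : ∀ R B → run (aboveWord R) (B , []) ≡ (B , map suc R)
  run-aboveWord []      B = refl
  run-aboveWord (c ∷ R) B = begin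
    run (DUs c ++ D ∷ aboveWord R ++ [ U ]) (B , [])           ≡⟨ run-++ (DUs c) (D ∷ aboveWord R ++ [ U ]) _ ⟩
    run (DUs c) (step D (run (aboveWord R ++ [ U ]) (B , [])))  ≡⟨ cong (run (DUs c) ∘ step D) (run-++ (aboveWord R) [ U ] _) ⟩
    run (DUs c) (step D (run (aboveWord R) (0 ∷ B , [])))       ≡⟨ cong (run (DUs c) ∘ step D) (run-aboveWord R (0 ∷ B)) ⟩
    run (DUs c) (B , 1 ∷ map suc R)                             ≡⟨ run-DUs c 1 B (map suc R) ⟩
    (B , c ℕ.+ 1 ∷ map suc R)                                   ≡⟨ cong (λ c′ → B , c′ ∷ map suc R) (ℕ.+-comm c 1) ⟩
    (B , suc c ∷ map suc R)                                     ∎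
    where open ≡.≡-Reasoning

  run-risingWord : ∀ M B → run (risingWord M) (B , []) ≡ (M ++ B , [])
  run-risingWord []      B = refl
  run-risingWord (d ∷ M) B = begin
    step U (run (DUs d ++ risingWord M) (B , []))    ≡⟨ cong (step U) (run-++ (DUs d) (risingWord M) _) ⟩
    run (U ∷ DUs d) (run (risingWord M) (B , []))    ≡⟨ cong (run (U ∷ DUs d)) (run-risingWord M B) ⟩
    run (U ∷ DUs d) (M ++ B , [])                    ≡⟨ run-U∷DUs d (M ++ B) ⟩
    (d ∷ M ++ B , [])                                ∎
    where open ≡.≡-Reasoning

  run-fallingWord : ∀ M A → run (fallingWord M) ([] , A) ≡ ([] , map suc M ++ A)
  run-fallingWord []      A = refl
  run-fallingWord (c ∷ M) A = begin
    step D (run (UDs c ++ fallingWord M) ([] , A))   ≡⟨ cong (step D) (run-++ (UDs c) (fallingWord M) _) ⟩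
    run (D ∷ UDs c) (run (fallingWord M) ([] , A))   ≡⟨ cong (run (D ∷ UDs c)) (run-fallingWord M A) ⟩
    run (D ∷ UDs c) ([] , map suc M ++ A)            ≡⟨ run-D∷UDs c (map suc M ++ A) ⟩
    ([] , suc c ∷ map suc M ++ A)                    ∎
    where open ≡.≡-Reasoning

  zipper-representative : ∀ σ → zipper (representative σ) ≡ shapeZipper σ
  zipper-representative ((L , R) , rising M) = begin
    run (aboveWord R ++ risingWord M ++ belowWord L) ([] , [])
      ≡⟨ trans (run-++ (aboveWord R) _ _) (cong (run (aboveWord R)) (run-++ (risingWord M) _ _)) ⟩
    run (aboveWord R) (run (risingWord M) (run (belowWord L) ([] , [])))
      ≡⟨ cong (run (aboveWord R) ∘ run (risingWord M)) (run-belowWord L []) ⟩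
    run (aboveWord R) (run (risingWord M) (map suc L , []))
      ≡⟨ cong (run (aboveWord R)) (run-risingWord M (map suc L)) ⟩
    run (aboveWord R) (M ++ map suc L , [])
      ≡⟨ run-aboveWord R (M ++ map suc L) ⟩
    (M ++ map suc L , map suc R)
      ∎
    where open ≡.≡-Reasoning
  zipper-representative ((L , R) , falling m M) = begin
    run (belowWord L ++ fallingWord (m ∷ M) ++ aboveWord R) ([] , [])
      ≡⟨ trans (run-++ (belowWord L) _ _) (cong (run (belowWord L)) (run-++ (fallingWord (m ∷ M)) _ _)) ⟩
    run (belowWord L) (run (fallingWord (m ∷ M)) (run (aboveWord R) ([] , [])))
      ≡⟨ cong (run (belowWord L) ∘ run (fallingWord (m ∷ M))) (run-aboveWord R []) ⟩
    run (belowWord L) (run (fallingWord (m ∷ M)) ([] , map suc R))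
      ≡⟨ cong (run (belowWord L)) (run-fallingWord (m ∷ M) (map suc R)) ⟩
    run (belowWord L) ([] , map suc (m ∷ M) ++ map suc R)
      ≡⟨ run-belowWord L _ ⟩
    (map suc L , map suc (m ∷ M) ++ map suc R)
      ∎
    where open ≡.≡-Reasoning

  height-++ : ∀ a b → height (a ++ b) ≡ height a + height b
  height-++ []      b = sym (ℤ.+-identityˡ (height b))
  height-++ (U ∷ a) b = trans (cong ℤ.suc (height-++ a b)) (sym (ℤ.+-assoc 1ℤ (height a) (height b)))
  height-++ (D ∷ a) b = trans (cong ℤ.pred (height-++ a b)) (sym (ℤ.+-assoc -1ℤ (height a) (height b)))

  height-UDs : ∀ c → height (UDs c) ≡ 0ℤ
  height-UDs zero    = refl
  height-UDs (suc c) = cong (λ h → 1ℤ + (-1ℤ + h)) (height-UDs c)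

  height-DUs : ∀ c → height (DUs c) ≡ 0ℤ
  height-DUs zero    = refl
  height-DUs (suc c) = cong (λ h → -1ℤ + (1ℤ + h)) (height-DUs c)

  height-belowWord : ∀ L → height (belowWord L) ≡ 0ℤ
  height-belowWord []      = refl
  height-belowWord (c ∷ L) =
    trans (height-++ (UDs c) _)
      (cong₂ (λ x y → x + (1ℤ + y)) (height-UDs c) (trans (height-++ (belowWord L) [ D ]) (cong (_+ -1ℤ) (height-belowWord L))))

  height-aboveWord : ∀ R → height (aboveWord R) ≡ 0ℤ
  height-aboveWord []      = refl
  height-aboveWord (c ∷ R) =
    trans (height-++ (DUs c) _)
      (cong₂ (λ x y → x + (-1ℤ + y)) (height-DUs c) (trans (height-++ (aboveWord R) [ U ]) (cong (_+ 1ℤ) (height-aboveWord R))))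

  height-risingWord : ∀ M → height (risingWord M) ≡ + length M
  height-risingWord []      = refl
  height-risingWord (d ∷ M) = cong ℤ.suc (begin
    height (DUs d ++ risingWord M)          ≡⟨ height-++ (DUs d) (risingWord M) ⟩
    height (DUs d) + height (risingWord M)  ≡⟨ cong₂ _+_ (height-DUs d) (height-risingWord M) ⟩
    0ℤ + + length M                         ≡⟨ ℤ.+-identityˡ (+ length M) ⟩
    + length M                              ∎)
    where open ≡.≡-Reasoning

  height-fallingWord : ∀ M → height (fallingWord M) ≡ - + length M
  height-fallingWord []      = refl
  height-fallingWord (c ∷ M) = begin
    ℤ.pred (height (UDs c ++ fallingWord M))          ≡⟨ cong ℤ.pred (height-++ (UDs c) (fallingWord M)) ⟩
    ℤ.pred (height (UDs c) + height (fallingWord M))  ≡⟨ cong₂ (λ x y → ℤ.pred (x + y)) (height-UDs c) (height-fallingWord M) ⟩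
    ℤ.pred (0ℤ + - + length M)                        ≡⟨ cong ℤ.pred (ℤ.+-identityˡ (- + length M)) ⟩
    -1ℤ + - + length M                                ≡⟨ lemma (+ length M) ⟩
    - + suc (length M)                                ∎
    where
    open ≡.≡-Reasoning
    lemma : ∀ x → -1ℤ + - x ≡ - (1ℤ + x)
    lemma = solve-∀

  height-representative : ∀ σ → height (representative σ) ≡ shapeHeight σ
  height-representative ((L , R) , rising M) = begin
    height (aboveWord R ++ risingWord M ++ belowWord L)
      ≡⟨ height-++ (aboveWord R) _ ⟩
    height (aboveWord R) + height (risingWord M ++ belowWord L)
      ≡⟨ cong₂ _+_ (height-aboveWord R) (height-++ (risingWord M) _) ⟩
    0ℤ + (height (risingWord M) + height (belowWord L))
      ≡⟨ cong₂ (λ x y → 0ℤ + (x + y)) (height-risingWord M) (height-belowWord L) ⟩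
    0ℤ + (+ length M + 0ℤ)
      ≡⟨ trans (ℤ.+-identityˡ _) (ℤ.+-identityʳ _) ⟩
    + length M
      ∎
    where open ≡.≡-Reasoning
  height-representative ((L , R) , falling m M) = begin
    height (belowWord L ++ fallingWord (m ∷ M) ++ aboveWord R)
      ≡⟨ height-++ (belowWord L) _ ⟩
    height (belowWord L) + height (fallingWord (m ∷ M) ++ aboveWord R)
      ≡⟨ cong₂ _+_ (height-belowWord L) (height-++ (fallingWord (m ∷ M)) _) ⟩
    0ℤ + (height (fallingWord (m ∷ M)) + height (aboveWord R))
      ≡⟨ cong₂ (λ x y → 0ℤ + (x + y)) (height-fallingWord (m ∷ M)) (height-aboveWord R) ⟩
    0ℤ + (-[1+ length M ] + 0ℤ)
      ≡⟨ trans (ℤ.+-identityˡ _) (ℤ.+-identityʳ _) ⟩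
    -[1+ length M ]
      ∎
    where open ≡.≡-Reasoning

  fromZipper : ℤ → Zipper → Shape
  fromZipper (+ k)    (B , A)     = (map ℕ.pred (drop k B) , map ℕ.pred A) , rising (take k B)
  fromZipper -[1+ k ] (B , a ∷ A) = (map ℕ.pred B , map ℕ.pred (drop k A)) , falling (ℕ.pred a) (map ℕ.pred (take k A))
  fromZipper -[1+ k ] (B , [])    = ([] , []) , rising []   -- junk: not a valid zipper

  private
    map-pred-suc : ∀ L → map ℕ.pred (map suc L) ≡ L
    map-pred-suc []      = refl
    map-pred-suc (x ∷ L) = cong (x ∷_) (map-pred-suc L)

    map-suc-pred : ∀ {L} → All (0 <_) L → map suc (map ℕ.pred L) ≡ L
    map-suc-pred []            = refl
    map-suc-pred (s≤s _ ∷ L⁺) = cong (_ ∷_) (map-suc-pred L⁺)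

    take-length-++ : ∀ {A : Set} (xs ys : List A) → take (length xs) (xs ++ ys) ≡ xs
    take-length-++ []       ys = refl
    take-length-++ (x ∷ xs) ys = cong (x ∷_) (take-length-++ xs ys)

    drop-length-++ : ∀ {A : Set} (xs ys : List A) → drop (length xs) (xs ++ ys) ≡ ys
    drop-length-++ []       ys = refl
    drop-length-++ (x ∷ xs) ys = drop-length-++ xs ys

    length-take-≤ : ∀ {A : Set} k (xs : List A) → k ≤ length xs → length (take k xs) ≡ k
    length-take-≤ zero    xs       _       = refl
    length-take-≤ (suc k) (x ∷ xs) (s≤s p) = cong suc (length-take-≤ k xs p)

  fromZipper-shape : ∀ σ → fromZipper (shapeHeight σ) (shapeZipper σ) ≡ σ
  fromZipper-shape ((L , R) , rising M) =
    cong₂ _,_ (cong₂ _,_ (trans (cong (map ℕ.pred) (drop-length-++ M (map suc L))) (map-pred-suc L)) (map-pred-suc R))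
              (cong rising (take-length-++ M (map suc L)))
  fromZipper-shape ((L , R) , falling m M) =
    cong₂ _,_ (cong₂ _,_ (map-pred-suc L) (trans (cong (map ℕ.pred) (drop-suc-++ M)) (map-pred-suc R)))
              (cong (falling m) (trans (cong (map ℕ.pred) (take-suc-++ M)) (map-pred-suc M)))
    where
    drop-suc-++ : ∀ M → drop (length M) (map suc M ++ map suc R) ≡ map suc R
    drop-suc-++ M = trans (cong (λ n → drop n (map suc M ++ map suc R)) (sym (length-map suc M))) (drop-length-++ (map suc M) _)
    take-suc-++ : ∀ M → take (length M) (map suc M ++ map suc R) ≡ map suc M
    take-suc-++ M = trans (cong (λ n → take n (map suc M ++ map suc R)) (sym (length-map suc M))) (take-length-++ (map suc M) _)

  shape-fromZipper : ∀ h z → Valid h z → shapeHeight (fromZipper h z) ≡ h × shapeZipper (fromZipper h z) ≡ z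
  shape-fromZipper (+ k) (B , A) (k≤ , B⁺ , A⁺) =
    cong +_ (length-take-≤ k B k≤) ,
    cong₂ _,_ (trans (cong (take k B ++_) (map-suc-pred B⁺)) (take++drop≡id k B)) (map-suc-pred A⁺)
  shape-fromZipper -[1+ k ] (B , suc a ∷ A) (B⁺ , _ ∷ A⁺ , s≤s k≤) =
    cong -[1+_] (trans (length-map ℕ.pred (take k A)) (length-take-≤ k A k≤)) ,
    cong₂ _,_ (map-suc-pred B⁺)
      (cong (suc a ∷_) (trans (cong₂ _++_ (map-suc-pred (All.take⁺ k A⁺)) (map-suc-pred (All.drop⁺ k A⁺)))
                              (take++drop≡id k A)))

  valid-shape : ∀ σ → Valid (shapeHeight σ) (shapeZipper σ)
  valid-shape σ = subst₂ Valid (height-representative σ) (zipper-representative σ) (valid-zipper (representative σ))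

  downHeights-representative : ∀ σ → downHeights (representative σ) ↭ heightsAt (shapeHeight σ) (shapeZipper σ)
  downHeights-representative σ = ↭-trans (downHeights-zipper (representative σ))
    (↭-reflexive (cong₂ heightsAt (height-representative σ) (zipper-representative σ)))

  representative-injective : ∀ σ σ′ → height (representative σ) ≡ height (representative σ′) →
                             downHeights (representative σ) ↭ downHeights (representative σ′) → σ ≡ σ′
  representative-injective σ σ′ h≡h′ p = begin
    σ                                               ≡⟨ fromZipper-shape σ ⟨
    fromZipper (shapeHeight σ) (shapeZipper σ)      ≡⟨ cong₂ fromZipper sh≡ sz≡ ⟩
    fromZipper (shapeHeight σ′) (shapeZipper σ′)    ≡⟨ fromZipper-shape σ′ ⟩
    σ′                                              ∎
    where
    open ≡.≡-Reasoning
    sh≡ : shapeHeight σ ≡ shapeHeight σ′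
    sh≡ = trans (sym (height-representative σ)) (trans h≡h′ (height-representative σ′))
    sz≡ : shapeZipper σ ≡ shapeZipper σ′
    sz≡ = heightsAt-injective (shapeHeight σ) (valid-shape σ) (subst (λ h → Valid h _) (sym sh≡) (valid-shape σ′))
            (↭-trans (↭-sym (downHeights-representative σ))
              (↭-trans p (subst (λ h → _ ↭ heightsAt h (shapeZipper σ′)) (sym sh≡) (downHeights-representative σ′))))

  shapeOf : Word → Shape
  shapeOf w = fromZipper (height w) (zipper w)

  canonical : Word → Word
  canonical w = representative (shapeOf w)

  height-canonical : ∀ w → height (canonical w) ≡ height w
  height-canonical w =
    trans (height-representative (shapeOf w)) (proj₁ (shape-fromZipper (height w) (zipper w) (valid-zipper w)))

  downHeights-canonical : ∀ w → downHeights w ↭ downHeights (canonical w)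
  downHeights-canonical w = ↭-trans (downHeights-zipper w)
    (↭-trans (↭-reflexive (sym shape≡)) (↭-sym (downHeights-representative (shapeOf w))))
    where
    shape≡ : heightsAt (shapeHeight (shapeOf w)) (shapeZipper (shapeOf w)) ≡ heightsAt (height w) (zipper w)
    shape≡ = let h≡ , z≡ = shape-fromZipper (height w) (zipper w) (valid-zipper w) in cong₂ heightsAt h≡ z≡

  length-height : ∀ w → + length w ≡ height w + (+ length (downHeights w) + + length (downHeights w))
  length-height []      = refl
  length-height (U ∷ w) = trans (cong ℤ.suc (length-height w)) (sym (ℤ.+-assoc 1ℤ (height w) _))
  length-height (D ∷ w) = trans (cong ℤ.suc (length-height w)) (lemma (height w) (+ length (downHeights w)))
    where
    lemma : ∀ h n → 1ℤ + (h + (n + n)) ≡ (-1ℤ + h) + ((1ℤ + n) + (1ℤ + n))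
    lemma = solve-∀

  height-determined : ∀ {u v} → length u ≡ length v → downHeights u ↭ downHeights v → height u ≡ height v
  height-determined {u} {v} lu≡lv p = ∙-cancelʳ _ (height u) (height v) (begin
    height u + (+ n + + n)                                                ≡⟨ length-height u ⟨
    + length u                                                            ≡⟨ cong +_ lu≡lv ⟩
    + length v                                                            ≡⟨ length-height v ⟩
    height v + (+ length (downHeights v) + + length (downHeights v))      ≡⟨ cong (λ m → height v + (+ m + + m)) (↭.↭-length p) ⟨
    height v + (+ n + + n)                                                ∎)
    where
    open ≡.≡-Reasoning
    n = length (downHeights u)

  length-canonical : ∀ w → length (canonical w) ≡ length w
  length-canonical w = ℤ.+-injective (begin
    + length (canonical w)                                         ≡⟨ length-height (canonical w) ⟩
    height (canonical w) + (+ length (downHeights (canonical w)) + + length (downHeights (canonical w)))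
      ≡⟨ cong₂ (λ h m → h + (+ m + + m)) (height-canonical w) (↭.↭-length (↭-sym (downHeights-canonical w))) ⟩
    height w + (+ length (downHeights w) + + length (downHeights w)) ≡⟨ length-height w ⟨
    + length w                                                     ∎)
    where open ≡.≡-Reasoning

  excursionSize : ℕ → ℕ
  excursionSize zero    = 2
  excursionSize (suc c) = suc (suc (excursionSize c))

  stepSize : ℕ → ℕ
  stepSize zero    = 1
  stepSize (suc c) = suc (suc (stepSize c))

  excursionsSize : List ℕ → ℕ
  excursionsSize []      = 0
  excursionsSize (c ∷ L) = excursionSize c ℕ.+ excursionsSize L

  stepsSize : List ℕ → ℕ
  stepsSize []      = 0
  stepsSize (d ∷ M) = stepSize d ℕ.+ stepsSize M

  middleSize : Middle → ℕ
  middleSize (rising M)    = stepsSize M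
  middleSize (falling m M) = stepsSize (m ∷ M)

  size : Shape → ℕ
  size ((L , R) , middle) = (excursionsSize L ℕ.+ excursionsSize R) ℕ.+ middleSize middle

  private
    length-∷ʳ : ∀ (w : Word) x → length (w ++ [ x ]) ≡ suc (length w)
    length-∷ʳ w x = trans (length-++ w) (ℕ.+-comm (length w) 1)

  length-belowWord : ∀ L → length (belowWord L) ≡ excursionsSize L
  length-belowWord []          = refl
  length-belowWord (zero  ∷ L) = cong suc (trans (length-∷ʳ (belowWord L) D) (cong suc (length-belowWord L)))
  length-belowWord (suc c ∷ L) = cong (suc ∘ suc) (length-belowWord (c ∷ L))

  length-aboveWord : ∀ R → length (aboveWord R) ≡ excursionsSize R
  length-aboveWord []          = refl
  length-aboveWord (zero  ∷ R) = cong suc (trans (length-∷ʳ (aboveWord R) U) (cong suc (length-aboveWord R)))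
  length-aboveWord (suc c ∷ R) = cong (suc ∘ suc) (length-aboveWord (c ∷ R))

  length-risingWord : ∀ M → length (risingWord M) ≡ stepsSize M
  length-risingWord []          = refl
  length-risingWord (zero  ∷ M) = cong suc (length-risingWord M)
  length-risingWord (suc d ∷ M) = cong (suc ∘ suc) (length-risingWord (d ∷ M))

  length-fallingWord : ∀ M → length (fallingWord M) ≡ stepsSize M
  length-fallingWord []          = refl
  length-fallingWord (zero  ∷ M) = cong suc (length-fallingWord M)
  length-fallingWord (suc c ∷ M) = cong (suc ∘ suc) (length-fallingWord (c ∷ M))

  length-representative : ∀ σ → length (representative σ) ≡ size σ
  length-representative ((L , R) , rising M) = begin
    length (aboveWord R ++ risingWord M ++ belowWord L)
      ≡⟨ trans (length-++ (aboveWord R)) (cong (length (aboveWord R) ℕ.+_) (length-++ (risingWord M))) ⟩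
    length (aboveWord R) ℕ.+ (length (risingWord M) ℕ.+ length (belowWord L))
      ≡⟨ cong₂ ℕ._+_ (length-aboveWord R) (cong₂ ℕ._+_ (length-risingWord M) (length-belowWord L)) ⟩
    excursionsSize R ℕ.+ (stepsSize M ℕ.+ excursionsSize L)
      ≡⟨ lemma (excursionsSize L) (excursionsSize R) (stepsSize M) ⟩
    (excursionsSize L ℕ.+ excursionsSize R) ℕ.+ stepsSize M
      ∎
    where
    open ≡.≡-Reasoning
    lemma : ∀ l r m → r ℕ.+ (m ℕ.+ l) ≡ (l ℕ.+ r) ℕ.+ m
    lemma = ℕ-solve-∀
  length-representative ((L , R) , falling m M) = begin
    length (belowWord L ++ fallingWord (m ∷ M) ++ aboveWord R)
      ≡⟨ trans (length-++ (belowWord L)) (cong (length (belowWord L) ℕ.+_) (length-++ (fallingWord (m ∷ M)))) ⟩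
    length (belowWord L) ℕ.+ (length (fallingWord (m ∷ M)) ℕ.+ length (aboveWord R))
      ≡⟨ cong₂ ℕ._+_ (length-belowWord L) (cong₂ ℕ._+_ (length-fallingWord (m ∷ M)) (length-aboveWord R)) ⟩
    excursionsSize L ℕ.+ (stepsSize (m ∷ M) ℕ.+ excursionsSize R)
      ≡⟨ lemma (excursionsSize L) (excursionsSize R) (stepsSize (m ∷ M)) ⟩
    (excursionsSize L ℕ.+ excursionsSize R) ℕ.+ stepsSize (m ∷ M)
      ∎
    where
    open ≡.≡-Reasoning
    lemma : ∀ l r m → l ℕ.+ (m ℕ.+ r) ≡ (l ℕ.+ r) ℕ.+ m
    lemma = ℕ-solve-∀

open Shapes

module Enumerations where
  open import Data.Nat using (_+_; _*_; _≤_; _<_)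
  open ≡ using (refl; cong; cong₂; sym; trans; subst)

  record EnumeratesBySize {X : Set} (size : X → ℕ) (enum : ℕ → List X) : Set where
    field
      sound    : ∀ {n x} → x ∈ enum n → size x ≡ n
      complete : ∀ x → x ∈ enum (size x)
      unique   : ∀ n → Unique (enum n)

  mapCons : {B : Set} → (ℕ → List ℕ → B) → List (List ℕ) → List B
  mapCons f []            = []
  mapCons f ([] ∷ L)      = mapCons f L
  mapCons f ((c ∷ X) ∷ L) = f c X ∷ mapCons f L

  module _ {B : Set} (f : ℕ → List ℕ → B) where

    ∈-mapCons⁻ : ∀ L {y} → y ∈ mapCons f L → ∃₂ λ c X → (c ∷ X) ∈ L × y ≡ f c X
    ∈-mapCons⁻ ([] ∷ L)      y∈         = let c , X , cX∈ , eq = ∈-mapCons⁻ L y∈ in c , X , there cX∈ , eq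
    ∈-mapCons⁻ ((c ∷ X) ∷ L) (here eq)  = c , X , here refl , eq
    ∈-mapCons⁻ ((c ∷ X) ∷ L) (there y∈) = let c′ , X′ , cX∈ , eq = ∈-mapCons⁻ L y∈ in c′ , X′ , there cX∈ , eq

    ∈-mapCons⁺ : ∀ L {c X} → (c ∷ X) ∈ L → f c X ∈ mapCons f L
    ∈-mapCons⁺ ((c ∷ X) ∷ L) (here refl) = here refl
    ∈-mapCons⁺ ([] ∷ L)      (there cX∈) = ∈-mapCons⁺ L cX∈
    ∈-mapCons⁺ ((_ ∷ _) ∷ L) (there cX∈) = there (∈-mapCons⁺ L cX∈)

    mapCons-unique : (∀ {c X c′ X′} → f c X ≡ f c′ X′ → c ≡ c′ × X ≡ X′) →
                     ∀ {L} → Unique L → Unique (mapCons f L)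
    mapCons-unique f-inj {[]}          []         = []
    mapCons-unique f-inj {[] ∷ L}      (_ ∷ uL)   = mapCons-unique f-inj uL
    mapCons-unique f-inj {(c ∷ X) ∷ L} (cX∉ ∷ uL) = All.tabulate distinct ∷ mapCons-unique f-inj uL
      where
      distinct : ∀ {y} → y ∈ mapCons f L → f c X ≢ y
      distinct y∈ eq with ∈-mapCons⁻ L y∈
      ... | c′ , X′ , cX′∈ , refl with f-inj eq
      ...   | refl , refl = All.lookup cX∉ cX′∈ refl

    length-mapCons : ∀ L → All (_≢ []) L → length (mapCons f L) ≡ length L
    length-mapCons []            []          = refl
    length-mapCons ([] ∷ L)      ([]≢[] ∷ _) = ⊥-elim ([]≢[] refl)
    length-mapCons ((c ∷ X) ∷ L) (_ ∷ L≢[])  = cong suc (length-mapCons L L≢[])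

  nonempty : ∀ {size : List ℕ → ℕ} {enum} → EnumeratesBySize size enum → size [] ≡ 0 →
             ∀ n → All (_≢ []) (enum (suc n))
  nonempty {size} E size[]≡0 n = All.tabulate λ X∈ X≡[] →
    ℕ.0≢1+n (trans (sym size[]≡0) (trans (cong size (sym X≡[])) (EnumeratesBySize.sound E X∈)))

  incHead : ℕ → List ℕ → List ℕ
  incHead c X = suc c ∷ X

  private
    0∷-or-incHead-unique : ∀ {A B} → Unique A → Unique B → Unique (map (0 ∷_) A ++ mapCons incHead B)
    0∷-or-incHead-unique {A} {B} uA uB =
      Unique.++⁺ (Unique.map⁺ ∷-injectiveʳ uA) (mapCons-unique incHead incHead-injective uB) disjoint
      where
      incHead-injective : ∀ {c X c′ X′} → incHead c X ≡ incHead c′ X′ → c ≡ c′ × X ≡ X′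
      incHead-injective refl = refl , refl
      disjoint : ∀ {Y} → Y ∈ map (0 ∷_) A × Y ∈ mapCons incHead B → ⊥
      disjoint (Y∈A , Y∈B) with ∈-map⁻ (0 ∷_) Y∈A | ∈-mapCons⁻ incHead B Y∈B
      ... | _ , _ , refl | _ , _ , _ , ()

  excursionLists : ℕ → List (List ℕ)
  excursionLists zero          = [ [] ]
  excursionLists (suc zero)    = []
  excursionLists (suc (suc s)) = map (0 ∷_) (excursionLists s) ++ mapCons incHead (excursionLists s)

  excursionLists-enumerates : EnumeratesBySize excursionsSize excursionLists
  excursionLists-enumerates = record { sound = sound _ ; complete = complete ; unique = unique }
    where
    sound : ∀ n {L} → L ∈ excursionLists n → excursionsSize L ≡ n
    sound zero          (here refl) = refl
    sound (suc (suc s)) L∈          with ∈-++⁻ (map (0 ∷_) (excursionLists s)) L∈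
    ... | inj₁ L∈₀ = let _ , X∈ , eq = ∈-map⁻ (0 ∷_) L∈₀ in
                     trans (cong excursionsSize eq) (cong (suc ∘ suc) (sound s X∈))
    ... | inj₂ L∈₊ = let _ , _ , X∈ , eq = ∈-mapCons⁻ incHead (excursionLists s) L∈₊ in
                     trans (cong excursionsSize eq) (cong (suc ∘ suc) (sound s X∈))

    mutual
      complete : ∀ L → L ∈ excursionLists (excursionsSize L)
      complete []      = here refl
      complete (c ∷ L) = complete-∷ c L

      complete-∷ : ∀ c L → (c ∷ L) ∈ excursionLists (excursionsSize (c ∷ L))
      complete-∷ zero    L = ∈-++⁺ˡ (∈-map⁺ (0 ∷_) (complete L))
      complete-∷ (suc c) L = ∈-++⁺ʳ (map (0 ∷_) (excursionLists (excursionsSize (c ∷ L))))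
                                    (∈-mapCons⁺ incHead _ (complete-∷ c L))

    unique : ∀ n → Unique (excursionLists n)
    unique zero          = [] ∷ []
    unique (suc zero)    = []
    unique (suc (suc s)) = 0∷-or-incHead-unique (unique s) (unique s)

  stepLists : ℕ → List (List ℕ)
  stepLists zero          = [ [] ]
  stepLists (suc zero)    = map (0 ∷_) (stepLists zero)
  stepLists (suc (suc s)) = map (0 ∷_) (stepLists (suc s)) ++ mapCons incHead (stepLists s)

  stepLists-enumerates : EnumeratesBySize stepsSize stepLists
  stepLists-enumerates = record { sound = sound _ ; complete = complete ; unique = unique }
    where
    mutual
      sound : ∀ n {M} → M ∈ stepLists n → stepsSize M ≡ n
      sound zero    (here M≡[]) = cong stepsSize M≡[]
      sound (suc n) M∈          = sound-suc n M∈

      sound-suc : ∀ n {M} → M ∈ stepLists (suc n) → stepsSize M ≡ suc n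
      sound-suc zero    (here M≡[0]) = cong stepsSize M≡[0]
      sound-suc (suc s) M∈           with ∈-++⁻ (map (0 ∷_) (stepLists (suc s))) M∈
      ... | inj₁ M∈₀ = let _ , X∈ , eq = ∈-map⁻ (0 ∷_) M∈₀ in
                       trans (cong stepsSize eq) (cong suc (sound-suc s X∈))
      ... | inj₂ M∈₊ = let _ , _ , X∈ , eq = ∈-mapCons⁻ incHead (stepLists s) M∈₊ in
                       trans (cong stepsSize eq) (cong (suc ∘ suc) (sound s X∈))

    0∷-∈ : ∀ n {M} → M ∈ stepLists n → (0 ∷ M) ∈ stepLists (suc n)
    0∷-∈ zero    M∈ = ∈-map⁺ (0 ∷_) M∈
    0∷-∈ (suc n) M∈ = ∈-++⁺ˡ (∈-map⁺ (0 ∷_) M∈)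

    mutual
      complete : ∀ M → M ∈ stepLists (stepsSize M)
      complete []      = here refl
      complete (d ∷ M) = complete-∷ d M

      complete-∷ : ∀ d M → (d ∷ M) ∈ stepLists (stepsSize (d ∷ M))
      complete-∷ zero    M = 0∷-∈ (stepsSize M) (complete M)
      complete-∷ (suc d) M = ∈-++⁺ʳ (map (0 ∷_) (stepLists (suc (stepsSize (d ∷ M)))))
                                    (∈-mapCons⁺ incHead _ (complete-∷ d M))

    unique : ∀ n → Unique (stepLists n)
    unique zero          = [] ∷ []
    unique (suc zero)    = [] ∷ []
    unique (suc (suc s)) = 0∷-or-incHead-unique (unique (suc s)) (unique s)

  middles : ℕ → List Middle
  middles s = map rising (stepLists s) ++ mapCons falling (stepLists s)

  middles-enumerates : EnumeratesBySize middleSize middles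
  middles-enumerates = record { sound = sound ; complete = complete ; unique = unique }
    where
    open EnumeratesBySize stepLists-enumerates renaming (sound to stepsSound; complete to stepsComplete; unique to stepsUnique)
    sound : ∀ {n m} → m ∈ middles n → middleSize m ≡ n
    sound {n} m∈ with ∈-++⁻ (map rising (stepLists n)) m∈
    ... | inj₁ m∈↑ = let _ , M∈ , eq = ∈-map⁻ rising m∈↑ in trans (cong middleSize eq) (stepsSound M∈)
    ... | inj₂ m∈↓ = let _ , _ , M∈ , eq = ∈-mapCons⁻ falling (stepLists n) m∈↓ in trans (cong middleSize eq) (stepsSound M∈)

    complete : ∀ m → m ∈ middles (middleSize m)
    complete (rising M)    = ∈-++⁺ˡ (∈-map⁺ rising (stepsComplete M))
    complete (falling m M) = ∈-++⁺ʳ (map rising (stepLists (stepsSize (m ∷ M)))) (∈-mapCons⁺ falling _ (stepsComplete (m ∷ M)))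

    unique : ∀ n → Unique (middles n)
    unique n = Unique.++⁺ (Unique.map⁺ rising-injective (stepsUnique n))
                          (mapCons-unique falling falling-injective (stepsUnique n)) disjoint
      where
      rising-injective : ∀ {M M′} → rising M ≡ rising M′ → M ≡ M′
      rising-injective refl = refl
      falling-injective : ∀ {m M m′ M′} → falling m M ≡ falling m′ M′ → m ≡ m′ × M ≡ M′
      falling-injective refl = refl , refl
      disjoint : ∀ {x} → x ∈ map rising (stepLists n) × x ∈ mapCons falling (stepLists n) → ⊥
      disjoint (x∈↑ , x∈↓) with ∈-map⁻ rising x∈↑ | ∈-mapCons⁻ falling (stepLists n) x∈↓
      ... | _ , _ , refl | _ , _ , _ , ()

  -- Σ_{i + k = n} F i * G k
  convolution : (ℕ → ℕ) → (ℕ → ℕ) → ℕ → ℕ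
  convolution F G zero    = F 0 * G 0
  convolution F G (suc n) = convolution F (G ∘ suc) n + F (suc n) * G 0

  module _ {X Y : Set} where

    -- the pairs (x , y) with x ∈ f i and y ∈ g k for some i + k = n
    convolve : (ℕ → List X) → (ℕ → List Y) → ℕ → List (X × Y)
    convolve f g zero    = cartesianProduct (f 0) (g 0)
    convolve f g (suc n) = convolve f (g ∘ suc) n ++ cartesianProduct (f (suc n)) (g 0)

    length-cartesianProduct : ∀ (xs : List X) (ys : List Y) → length (cartesianProduct xs ys) ≡ length xs * length ys
    length-cartesianProduct []       ys = refl
    length-cartesianProduct (x ∷ xs) ys =
      trans (length-++ (map (x ,_) ys)) (cong₂ _+_ (length-map (x ,_) ys) (length-cartesianProduct xs ys))

    length-convolve : ∀ f g n → length (convolve f g n) ≡ convolution (length ∘ f) (length ∘ g) n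
    length-convolve f g zero    = length-cartesianProduct (f 0) (g 0)
    length-convolve f g (suc n) = trans (length-++ (convolve f (g ∘ suc) n))
      (cong₂ _+_ (length-convolve f (g ∘ suc) n) (length-cartesianProduct (f (suc n)) (g 0)))

    ∈-convolve⁻ : ∀ f g n {p} → p ∈ convolve f g n → ∃₂ λ i k → i + k ≡ n × proj₁ p ∈ f i × proj₂ p ∈ g k
    ∈-convolve⁻ f g zero    p∈ = let x∈ , y∈ = ∈-cartesianProduct⁻ (f 0) (g 0) p∈ in 0 , 0 , refl , x∈ , y∈
    ∈-convolve⁻ f g (suc n) p∈ with ∈-++⁻ (convolve f (g ∘ suc) n) p∈
    ... | inj₁ p∈₁ = let i , k , i+k≡n , x∈ , y∈ = ∈-convolve⁻ f (g ∘ suc) n p∈₁ in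
                     i , suc k , trans (ℕ.+-suc i k) (cong suc i+k≡n) , x∈ , y∈
    ... | inj₂ p∈₂ = let x∈ , y∈ = ∈-cartesianProduct⁻ (f (suc n)) (g 0) p∈₂ in
                     suc n , 0 , ℕ.+-identityʳ (suc n) , x∈ , y∈

    ∈-convolve⁺ : ∀ f g k {i n x y} → i + k ≡ n → x ∈ f i → y ∈ g k → (x , y) ∈ convolve f g n
    ∈-convolve⁺ f g zero    {i} {zero}  i+0≡n x∈ y∈ with refl ← trans (sym (ℕ.+-identityʳ i)) i+0≡n =
      ∈-cartesianProduct⁺ x∈ y∈
    ∈-convolve⁺ f g zero    {i} {suc n} i+0≡n x∈ y∈ with refl ← trans (sym (ℕ.+-identityʳ i)) i+0≡n =
      ∈-++⁺ʳ (convolve f (g ∘ suc) n) (∈-cartesianProduct⁺ x∈ y∈)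
    ∈-convolve⁺ f g (suc k) {i} {zero}  i+k≡0 x∈ y∈ = ⊥-elim (ℕ.0≢1+n (sym (trans (sym (ℕ.+-suc i k)) i+k≡0)))
    ∈-convolve⁺ f g (suc k) {i} {suc n} i+k≡n x∈ y∈ =
      ∈-++⁺ˡ (∈-convolve⁺ f (g ∘ suc) k (ℕ.suc-injective (trans (sym (ℕ.+-suc i k)) i+k≡n)) x∈ y∈)

    convolve-unique : ∀ f g → (∀ i → Unique (f i)) → (∀ k → Unique (g k)) →
                      (∀ {i i′ x} → x ∈ f i → x ∈ f i′ → i ≡ i′) → ∀ n → Unique (convolve f g n)
    convolve-unique f g uf ug f-sized zero    = Unique.cartesianProduct⁺ (uf 0) (ug 0)
    convolve-unique f g uf ug f-sized (suc n) =
      Unique.++⁺ (convolve-unique f (g ∘ suc) uf (ug ∘ suc) f-sized n) (Unique.cartesianProduct⁺ (uf (suc n)) (ug 0)) disjoint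
      where
      disjoint : ∀ {p} → p ∈ convolve f (g ∘ suc) n × p ∈ cartesianProduct (f (suc n)) (g 0) → ⊥
      disjoint (p∈₁ , p∈₂) with ∈-convolve⁻ f (g ∘ suc) n p∈₁ | ∈-cartesianProduct⁻ (f (suc n)) (g 0) p∈₂
      ... | i , k , i+k≡n , x∈ , _ | x∈′ , _ =
        ℕ.<-irrefl (f-sized x∈ x∈′) (s≤s (subst (i ≤_) i+k≡n (ℕ.m≤m+n i k)))

  convolve-enumerates : ∀ {X Y} {s₁ : X → ℕ} {s₂ : Y → ℕ} {f g} → EnumeratesBySize s₁ f → EnumeratesBySize s₂ g →
                           EnumeratesBySize (λ (x , y) → s₁ x + s₂ y) (convolve f g)
  convolve-enumerates {s₁ = s₁} {s₂} {f} {g} enum₁ enum₂ = record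
    { sound    = λ {n} p∈ → let i , k , i+k≡n , x∈ , y∈ = ∈-convolve⁻ f g n p∈ in
                            trans (cong₂ _+_ (E₁.sound x∈) (E₂.sound y∈)) i+k≡n
    ; complete = λ (x , y) → ∈-convolve⁺ f g (s₂ y) refl (E₁.complete x) (E₂.complete y)
    ; unique   = convolve-unique f g E₁.unique E₂.unique (λ x∈ x∈′ → trans (sym (E₁.sound x∈)) (E₁.sound x∈′))
    }
    where
    module E₁ = EnumeratesBySize enum₁
    module E₂ = EnumeratesBySize enum₂

  shapes : ℕ → List Shape
  shapes = convolve (convolve excursionLists excursionLists) middles

  shapes-enumerates : EnumeratesBySize size shapes
  shapes-enumerates =
    convolve-enumerates (convolve-enumerates excursionLists-enumerates excursionLists-enumerates)
                           middles-enumerates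

  excursionCount stepCount middleCount : ℕ → ℕ
  excursionCount = length ∘ excursionLists
  stepCount      = length ∘ stepLists
  middleCount    = length ∘ middles

  convolution-cong : ∀ {F F′ G G′} → (∀ i → F i ≡ F′ i) → (∀ k → G k ≡ G′ k) →
                     ∀ n → convolution F G n ≡ convolution F′ G′ n
  convolution-cong F≗ G≗ zero    = cong₂ _*_ (F≗ 0) (G≗ 0)
  convolution-cong F≗ G≗ (suc n) = cong₂ _+_ (convolution-cong F≗ (G≗ ∘ suc) n) (cong₂ _*_ (F≗ (suc n)) (G≗ 0))

  length-shapes : ∀ n → length (shapes n) ≡ convolution (convolution excursionCount excursionCount) middleCount n
  length-shapes n = trans (length-convolve _ middles n) (convolution-cong (length-convolve excursionLists excursionLists) (λ _ → refl) n)

  excursionCount-rec : ∀ s → excursionCount (3 + s) ≡ excursionCount (1 + s) + excursionCount (1 + s)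
  excursionCount-rec s = trans (length-++ (map (0 ∷_) (excursionLists (suc s))))
    (cong₂ _+_ (length-map (0 ∷_) (excursionLists (suc s)))
               (length-mapCons incHead _ (nonempty excursionLists-enumerates refl s)))

  stepCount-rec : ∀ s → stepCount (3 + s) ≡ stepCount (2 + s) + stepCount (1 + s)
  stepCount-rec s = trans (length-++ (map (0 ∷_) (stepLists (2 + s))))
    (cong₂ _+_ (length-map (0 ∷_) (stepLists (2 + s)))
               (length-mapCons incHead _ (nonempty stepLists-enumerates refl s)))

  middleCount-suc : ∀ s → middleCount (suc s) ≡ 2 * stepCount (suc s)
  middleCount-suc s = trans (length-++ (map rising (stepLists (suc s))))
    (trans (cong₂ _+_ (length-map rising (stepLists (suc s)))
                      (length-mapCons falling _ (nonempty stepLists-enumerates refl s)))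
           (cong (stepCount (suc s) +_) (sym (ℕ.+-identityʳ _))))

open Enumerations

module ClassCounts where
  open import Data.Nat using (_+_; _*_; _^_)
  open import Data.Nat.Tactic.RingSolver using (solve-∀)
  open ≡ using (refl; cong; cong₂; sym; trans)

  pairCount : ℕ → ℕ
  pairCount = convolution excursionCount excursionCount

  shapeCount : ℕ → ℕ
  shapeCount = convolution pairCount middleCount

  δ₀ : ℕ → ℕ
  δ₀ zero    = 1
  δ₀ (suc _) = 0

  convolution-+ : ∀ (F G H : ℕ → ℕ) n → convolution F (λ k → G k + H k) n ≡ convolution F G n + convolution F H n
  convolution-+ F G H zero    = ℕ.*-distribˡ-+ (F 0) (G 0) (H 0)
  convolution-+ F G H (suc n) = trans
    (cong₂ _+_ (convolution-+ F (G ∘ suc) (H ∘ suc) n) (ℕ.*-distribˡ-+ (F (suc n)) (G 0) (H 0)))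
    (regroup (convolution F (G ∘ suc) n) (convolution F (H ∘ suc) n) (F (suc n) * G 0) (F (suc n) * H 0))
    where
    regroup : ∀ a b c d → (a + b) + (c + d) ≡ (a + c) + (b + d)
    regroup = solve-∀

  convolution-δ₀ : ∀ (F : ℕ → ℕ) n → convolution F δ₀ n ≡ F n
  convolution-δ₀ F zero    = ℕ.*-identityʳ (F 0)
  convolution-δ₀ F (suc n) = cong₂ _+_ (vanish F n) (ℕ.*-identityʳ (F (suc n)))
    where
    vanish : ∀ (F : ℕ → ℕ) n → convolution F (δ₀ ∘ suc) n ≡ 0
    vanish F zero    = ℕ.*-zeroʳ (F 0)
    vanish F (suc n) = cong₂ _+_ (vanish F n) (ℕ.*-zeroʳ (F (suc n)))

  convolution-shift² : ∀ (F G H : ℕ → ℕ) → (∀ k → G (2 + k) + δ₀ k ≡ H k) →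
                       ∀ n → convolution F (λ k → G (2 + k)) n + F n ≡ convolution F H n
  convolution-shift² F G H rec n = begin
    convolution F (λ k → G (2 + k)) n + F n                   ≡⟨ cong (convolution F (λ k → G (2 + k)) n +_) (convolution-δ₀ F n) ⟨
    convolution F (λ k → G (2 + k)) n + convolution F δ₀ n    ≡⟨ convolution-+ F (λ k → G (2 + k)) δ₀ n ⟨
    convolution F (λ k → G (2 + k) + δ₀ k) n                ≡⟨ convolution-cong (λ _ → refl) rec n ⟩
    convolution F H n                                       ∎
    where open ≡.≡-Reasoning

  pairCount-rec : ∀ n → pairCount (2 + n) + excursionCount n ≡ (pairCount n + pairCount n) + excursionCount (2 + n)
  pairCount-rec n = begin
    (convolution eC (λ k → eC (2 + k)) n + eC (1 + n) * 0) + eC (2 + n) * 1 + eC n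
      ≡⟨ regroup (convolution eC (λ k → eC (2 + k)) n) (eC (1 + n)) (eC (2 + n)) (eC n) ⟩
    (convolution eC (λ k → eC (2 + k)) n + eC n) + eC (2 + n)
      ≡⟨ cong (_+ eC (2 + n)) (convolution-shift² eC eC (λ k → eC k + eC k) eC-rec n) ⟩
    convolution eC (λ k → eC k + eC k) n + eC (2 + n)
      ≡⟨ cong (_+ eC (2 + n)) (convolution-+ eC eC eC n) ⟩
    (pairCount n + pairCount n) + eC (2 + n)
      ∎
    where
    open ≡.≡-Reasoning
    eC = excursionCount
    regroup : ∀ a b c d → (a + b * 0) + c * 1 + d ≡ (a + d) + c
    regroup = solve-∀
    eC-rec : ∀ k → eC (2 + k) + δ₀ k ≡ eC k + eC k
    eC-rec zero    = refl
    eC-rec (suc k) = trans (ℕ.+-identityʳ _) (excursionCount-rec k)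

  shapeCount-rec : ∀ n → shapeCount (2 + n) + pairCount n ≡
                         ((shapeCount (1 + n) + shapeCount n) + pairCount (1 + n)) + pairCount (2 + n)
  shapeCount-rec n = begin
    (convolution P (λ k → mC (2 + k)) n + P (1 + n) * 2) + P (2 + n) * 1 + P n
      ≡⟨ regroup₁ (convolution P (λ k → mC (2 + k)) n) (P (1 + n)) (P (2 + n)) (P n) ⟩
    (convolution P (λ k → mC (2 + k)) n + P n) + (P (1 + n) * 2 + P (2 + n))
      ≡⟨ cong (_+ (P (1 + n) * 2 + P (2 + n))) (convolution-shift² P mC (λ k → mC (1 + k) + mC k) mC-rec n) ⟩
    convolution P (λ k → mC (1 + k) + mC k) n + (P (1 + n) * 2 + P (2 + n))
      ≡⟨ cong (_+ (P (1 + n) * 2 + P (2 + n))) (convolution-+ P (λ k → mC (1 + k)) mC n) ⟩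
    (convolution P (λ k → mC (1 + k)) n + shapeCount n) + (P (1 + n) * 2 + P (2 + n))
      ≡⟨ regroup₂ (convolution P (λ k → mC (1 + k)) n) (shapeCount n) (P (1 + n)) (P (2 + n)) ⟩
    (((convolution P (λ k → mC (1 + k)) n + P (1 + n) * 1) + shapeCount n) + P (1 + n)) + P (2 + n)
      ∎
    where
    open ≡.≡-Reasoning
    P = pairCount
    mC = middleCount
    regroup₁ : ∀ a p q r → ((a + p * 2) + q * 1) + r ≡ (a + r) + (p * 2 + q)
    regroup₁ = solve-∀
    regroup₂ : ∀ a t p q → (a + t) + (p * 2 + q) ≡ (((a + p * 1) + t) + p) + q
    regroup₂ = solve-∀
    mC-rec : ∀ k → mC (2 + k) + δ₀ k ≡ mC (1 + k) + mC k
    mC-rec zero    = refl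
    mC-rec (suc k) = begin
      mC (3 + k) + 0                                   ≡⟨ ℕ.+-identityʳ _ ⟩
      mC (3 + k)                                       ≡⟨ middleCount-suc (2 + k) ⟩
      2 * stepCount (3 + k)                            ≡⟨ cong (2 *_) (stepCount-rec k) ⟩
      2 * (stepCount (2 + k) + stepCount (1 + k))      ≡⟨ ℕ.*-distribˡ-+ 2 (stepCount (2 + k)) _ ⟩
      2 * stepCount (2 + k) + 2 * stepCount (1 + k)    ≡⟨ cong₂ _+_ (middleCount-suc (1 + k)) (middleCount-suc k) ⟨
      mC (2 + k) + mC (1 + k)                          ∎

  twice : ℕ → ℕ
  twice zero    = zero
  twice (suc m) = suc (suc (twice m))

  twice≡2* : ∀ m → twice m ≡ 2 * m
  twice≡2* zero    = refl
  twice≡2* (suc m) = trans (cong (suc ∘ suc) (twice≡2* m)) (sym (ℕ.*-suc 2 m))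

  excursionCount-odd : ∀ m → excursionCount (1 + twice m) ≡ 0
  excursionCount-odd zero    = refl
  excursionCount-odd (suc m) = trans (excursionCount-rec (twice m)) (cong₂ _+_ (excursionCount-odd m) (excursionCount-odd m))

  excursionCount-even : ∀ m → excursionCount (2 + twice m) ≡ 2 ^ m
  excursionCount-even zero    = refl
  excursionCount-even (suc m) = trans (excursionCount-rec (1 + twice m))
    (trans (cong₂ _+_ (excursionCount-even m) (excursionCount-even m)) (cong (2 ^ m +_) (sym (ℕ.+-identityʳ (2 ^ m)))))

  pairCount-odd : ∀ m → pairCount (1 + twice m) ≡ 0
  pairCount-odd zero    = refl
  pairCount-odd (suc m) = ℕ.+-cancelʳ-≡ (excursionCount (1 + twice m)) _ _ (begin
    pairCount (3 + twice m) + excursionCount (1 + twice m)              ≡⟨ pairCount-rec (1 + twice m) ⟩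
    (pairCount (1 + twice m) + pairCount (1 + twice m)) + excursionCount (3 + twice m)
      ≡⟨ cong₂ (λ p e → (p + p) + e) (pairCount-odd m) (excursionCount-odd (suc m)) ⟩
    0                                                                   ≡⟨ excursionCount-odd m ⟨
    0 + excursionCount (1 + twice m)                                    ∎)
    where open ≡.≡-Reasoning

  pairCount-even : ∀ m → 4 * pairCount (2 + twice m) ≡ (2 * m + 8) * 2 ^ m
  pairCount-even zero    = refl
  pairCount-even (suc m) = ℕ.+-cancelʳ-≡ (4 * 2 ^ m) _ _ (begin
    4 * P (4 + twice m) + 4 * 2 ^ m                               ≡⟨ cong (λ e → 4 * P (4 + twice m) + 4 * e) (excursionCount-even m) ⟨
    4 * P (4 + twice m) + 4 * excursionCount (2 + twice m)        ≡⟨ ℕ.*-distribˡ-+ 4 (P (4 + twice m)) _ ⟨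
    4 * (P (4 + twice m) + excursionCount (2 + twice m))          ≡⟨ cong (4 *_) (pairCount-rec (2 + twice m)) ⟩
    4 * ((P (2 + twice m) + P (2 + twice m)) + excursionCount (4 + twice m))
      ≡⟨ cong (λ e → 4 * ((P (2 + twice m) + P (2 + twice m)) + e)) (excursionCount-even (suc m)) ⟩
    4 * ((P (2 + twice m) + P (2 + twice m)) + 2 ^ suc m)         ≡⟨ regroup (P (2 + twice m)) (2 ^ m) ⟩
    (4 * P (2 + twice m) + 4 * P (2 + twice m)) + 8 * 2 ^ m       ≡⟨ cong (λ t → (t + t) + 8 * 2 ^ m) (pairCount-even m) ⟩
    ((2 * m + 8) * 2 ^ m + (2 * m + 8) * 2 ^ m) + 8 * 2 ^ m       ≡⟨ regroup′ m (2 ^ m) ⟩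
    (2 * suc m + 8) * 2 ^ suc m + 4 * 2 ^ m                       ∎)
    where
    open ≡.≡-Reasoning
    P = pairCount
    regroup : ∀ p k → 4 * ((p + p) + 2 * k) ≡ (4 * p + 4 * p) + 8 * k
    regroup = solve-∀
    regroup′ : ∀ m k → ((2 * m + 8) * k + (2 * m + 8) * k) + 8 * k ≡ (2 * (1 + m) + 8) * (2 * k) + 4 * k
    regroup′ = solve-∀

  EvenClosed OddClosed : ℕ → Set
  EvenClosed m = 8 * shapeCount (2 + twice m) + (6 * m + 48) * 2 ^ suc m ≡ 16 * fib (6 + twice m)
  OddClosed  m = 2 * shapeCount (1 + twice m) + (2 * m + 16) * 2 ^ m ≡ 4 * fib (5 + twice m)

  private
    odd-step : ∀ m → EvenClosed m → OddClosed m → OddClosed (suc m)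
    odd-step m even odd = ℕ.*-cancelˡ-≡ _ _ 4 (begin
      4 * (2 * O (suc m) + (2 * suc m + 16) * 2 ^ suc m)
        ≡⟨ cong (λ t → 4 * (2 * t + (2 * suc m + 16) * 2 ^ suc m)) O-rec ⟩
      4 * (2 * (E m + O m + P₂) + (2 * suc m + 16) * 2 ^ suc m)
        ≡⟨ regroup₁ (E m) (O m) P₂ m K ⟩
      (8 * E m + 8 * O m + (16 * m + 144) * K) + 2 * (4 * P₂)
        ≡⟨ cong (λ t → (8 * E m + 8 * O m + (16 * m + 144) * K) + 2 * t) (pairCount-even m) ⟩
      (8 * E m + 8 * O m + (16 * m + 144) * K) + 2 * ((2 * m + 8) * K)
        ≡⟨ regroup₂ (E m) (O m) m K ⟩
      (8 * E m + (6 * m + 48) * (2 * K)) + 4 * (2 * O m + (2 * m + 16) * K)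
        ≡⟨ cong₂ (λ a b → a + 4 * b) even odd ⟩
      16 * fib (6 + twice m) + 4 * (4 * fib (5 + twice m))
        ≡⟨ regroup₃ (fib (6 + twice m)) (fib (5 + twice m)) ⟩
      4 * (4 * fib (7 + twice m))
        ∎)
      where
      open ≡.≡-Reasoning
      E = λ m → shapeCount (2 + twice m)
      O = λ m → shapeCount (1 + twice m)
      K = 2 ^ m
      P₂ = pairCount (2 + twice m)
      O-rec : O (suc m) ≡ E m + O m + P₂
      O-rec = ℕ.+-cancelʳ-≡ (pairCount (1 + twice m)) _ _ (begin
        O (suc m) + pairCount (1 + twice m)          ≡⟨ shapeCount-rec (1 + twice m) ⟩
        E m + O m + P₂ + pairCount (3 + twice m)     ≡⟨ cong (E m + O m + P₂ +_) (pairCount-odd (suc m)) ⟩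
        E m + O m + P₂ + 0                           ≡⟨ cong (E m + O m + P₂ +_) (pairCount-odd m) ⟨
        E m + O m + P₂ + pairCount (1 + twice m)     ∎)
      regroup₁ : ∀ x y p m k → 4 * (2 * (x + y + p) + (2 * (1 + m) + 16) * (2 * k)) ≡
                               (8 * x + 8 * y + (16 * m + 144) * k) + 2 * (4 * p)
      regroup₁ = solve-∀
      regroup₂ : ∀ x y m k → (8 * x + 8 * y + (16 * m + 144) * k) + 2 * ((2 * m + 8) * k) ≡
                             (8 * x + (6 * m + 48) * (2 * k)) + 4 * (2 * y + (2 * m + 16) * k)
      regroup₂ = solve-∀
      regroup₃ : ∀ a b → 16 * a + 4 * (4 * b) ≡ 4 * (4 * (a + b))
      regroup₃ = solve-∀

    even-step : ∀ m → EvenClosed m → OddClosed (suc m) → EvenClosed (suc m)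
    even-step m even odd = ℕ.+-cancelʳ-≡ (8 * P₂) _ _ (begin
      8 * E (suc m) + (6 * suc m + 48) * 2 ^ suc (suc m) + 8 * P₂
        ≡⟨ regroup₁ (E (suc m)) P₂ (6 * suc m + 48) (2 ^ suc (suc m)) ⟩
      8 * (E (suc m) + P₂) + (6 * suc m + 48) * 2 ^ suc (suc m)
        ≡⟨ cong (λ t → 8 * t + (6 * suc m + 48) * 2 ^ suc (suc m)) E-rec ⟩
      8 * ((O (suc m) + E m) + P₄) + (6 * suc m + 48) * 2 ^ suc (suc m)
        ≡⟨ regroup₂ (O (suc m)) (E m) P₄ m K ⟩
      8 * O (suc m) + 8 * E m + 2 * (4 * P₄) + (24 * m + 216) * K
        ≡⟨ cong (λ t → 8 * O (suc m) + 8 * E m + 2 * t + (24 * m + 216) * K) (pairCount-even (suc m)) ⟩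
      8 * O (suc m) + 8 * E m + 2 * ((2 * suc m + 8) * 2 ^ suc m) + (24 * m + 216) * K
        ≡⟨ regroup₃ (O (suc m)) (E m) m K ⟩
      4 * (2 * O (suc m) + (2 * suc m + 16) * 2 ^ suc m) + (8 * E m + (6 * m + 48) * 2 ^ suc m) + 2 * ((2 * m + 8) * K)
        ≡⟨ cong₂ (λ a b → 4 * a + b + 2 * ((2 * m + 8) * K)) odd even ⟩
      4 * (4 * fib (7 + twice m)) + 16 * fib (6 + twice m) + 2 * ((2 * m + 8) * K)
        ≡⟨ cong (λ t → 4 * (4 * fib (7 + twice m)) + 16 * fib (6 + twice m) + 2 * t) (pairCount-even m) ⟨
      4 * (4 * fib (7 + twice m)) + 16 * fib (6 + twice m) + 2 * (4 * P₂)
        ≡⟨ regroup₄ (fib (7 + twice m)) (fib (6 + twice m)) P₂ ⟩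
      16 * fib (8 + twice m) + 8 * P₂
        ∎)
      where
      open ≡.≡-Reasoning
      E = λ m → shapeCount (2 + twice m)
      O = λ m → shapeCount (1 + twice m)
      K = 2 ^ m
      P₂ = pairCount (2 + twice m)
      P₄ = pairCount (4 + twice m)
      E-rec : E (suc m) + P₂ ≡ (O (suc m) + E m) + P₄
      E-rec = trans (shapeCount-rec (2 + twice m))
                    (trans (cong (λ p → ((O (suc m) + E m) + p) + P₄) (pairCount-odd (suc m)))
                           (cong (_+ P₄) (ℕ.+-identityʳ (O (suc m) + E m))))
      regroup₁ : ∀ x p c k → 8 * x + c * k + 8 * p ≡ 8 * (x + p) + c * k
      regroup₁ = solve-∀
      regroup₂ : ∀ y x p m k → 8 * ((y + x) + p) + (6 * (1 + m) + 48) * (2 * (2 * k)) ≡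
                               8 * y + 8 * x + 2 * (4 * p) + (24 * m + 216) * k
      regroup₂ = solve-∀
      regroup₃ : ∀ y x m k → 8 * y + 8 * x + 2 * ((2 * (1 + m) + 8) * (2 * k)) + (24 * m + 216) * k ≡
                             4 * (2 * y + (2 * (1 + m) + 16) * (2 * k)) + (8 * x + (6 * m + 48) * (2 * k)) + 2 * ((2 * m + 8) * k)
      regroup₃ = solve-∀
      regroup₄ : ∀ a b p → 4 * (4 * a) + 16 * b + 2 * (4 * p) ≡ 16 * (a + b) + 8 * p
      regroup₄ = solve-∀

  shapeCount-closed : ∀ m → EvenClosed m × OddClosed m
  shapeCount-closed zero    = refl , refl
  shapeCount-closed (suc m) =
    let even , odd = shapeCount-closed m
        odd′ = odd-step m even odd
    in even-step m even odd′ , odd′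

open ClassCounts

module Classes where
  open import Data.Nat using (_+_; _*_; _^_; _≤_; _<_; _≟_)
  open import Data.Nat.Tactic.RingSolver using (solve-∀)
  open ≡ using (refl; cong; cong₂; sym; trans; subst)

  Σ< : ℕ → (ℕ → ℕ) → ℕ
  Σ< k g = sum (applyUpTo g k)

  Σ<-cong : ∀ k {g h} → (∀ j → g j ≡ h j) → Σ< k g ≡ Σ< k h
  Σ<-cong zero    g≗h = refl
  Σ<-cong (suc k) g≗h = cong₂ _+_ (g≗h 0) (Σ<-cong k (λ j → g≗h (suc j)))

  Σ<-+ : ∀ k g h → Σ< k (λ j → g j + h j) ≡ Σ< k g + Σ< k h
  Σ<-+ zero    g h = refl
  Σ<-+ (suc k) g h = trans (cong (g 0 + h 0 +_) (Σ<-+ k (λ j → g (suc j)) (λ j → h (suc j))))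
                           (regroup (g 0) (h 0) (Σ< k (λ j → g (suc j))) (Σ< k (λ j → h (suc j))))
    where
    regroup : ∀ a b c d → a + b + (c + d) ≡ a + c + (b + d)
    regroup = solve-∀

  Σ<-zero : ∀ k → Σ< k (λ _ → 0) ≡ 0
  Σ<-zero zero    = refl
  Σ<-zero (suc k) = Σ<-zero k

  indicator : ℕ → ℕ → ℕ
  indicator c j = if does (c ≟ j) then 1 else 0

  Σ<-indicator : ∀ k c → c < k → Σ< k (indicator c) ≡ 1
  Σ<-indicator (suc k) zero    _       = cong suc (Σ<-zero k)
  Σ<-indicator (suc k) (suc c) (s≤s c<k) = Σ<-indicator k c c<k

  length-filter-∷ : ∀ {A : Set} (key : A → ℕ) j x xs →
                    length (filter (λ y → key y ≟ j) (x ∷ xs)) ≡ indicator (key x) j + length (filter (λ y → key y ≟ j) xs)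
  length-filter-∷ key j x xs with does (key x ≟ j)
  ... | true  = refl
  ... | false = refl

  Σ<-length-filter : ∀ {A : Set} (key : A → ℕ) k xs → All (λ x → key x < k) xs →
                     Σ< k (λ j → length (filter (λ y → key y ≟ j) xs)) ≡ length xs
  Σ<-length-filter key k []       []            = Σ<-zero k
  Σ<-length-filter key k (x ∷ xs) (x<k ∷ xs<k) = begin
    Σ< k (λ j → length (filter (λ y → key y ≟ j) (x ∷ xs)))
      ≡⟨ Σ<-cong k (λ j → length-filter-∷ key j x xs) ⟩
    Σ< k (λ j → indicator (key x) j + length (filter (λ y → key y ≟ j) xs))
      ≡⟨ Σ<-+ k (indicator (key x)) _ ⟩
    Σ< k (indicator (key x)) + Σ< k (λ j → length (filter (λ y → key y ≟ j) xs))
      ≡⟨ cong₂ _+_ (Σ<-indicator k (key x) x<k) (Σ<-length-filter key k xs xs<k) ⟩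
    suc (length xs)
      ∎
    where open ≡.≡-Reasoning

  countD≡length-downHeights : ∀ w → countD w ≡ length (downHeights w)
  countD≡length-downHeights []      = refl
  countD≡length-downHeights (D ∷ w) = cong suc (countD≡length-downHeights w)
  countD≡length-downHeights (U ∷ w) = countD≡length-downHeights w

  countD≤length : ∀ w → countD w ≤ length w
  countD≤length []      = z≤n
  countD≤length (D ∷ w) = s≤s (countD≤length w)
  countD≤length (U ∷ w) = ℕ.m≤n⇒m≤1+n (countD≤length w)

  representatives : ℕ → List Word
  representatives n = map representative (shapes n)

  length-representatives : ∀ n {r} → r ∈ representatives n → length r ≡ n
  length-representatives n r∈ =
    let σ , σ∈ , r≡ = ∈-map⁻ representative r∈ in
    trans (cong length r≡) (trans (length-representative σ) (EnumeratesBySize.sound shapes-enumerates σ∈))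

  classes : ℕ → ℕ → List Word
  classes n j = filter (λ r → countD r ≟ j) (representatives n)

  classCount : ℕ → ℕ → ℕ
  classCount n j = length (classes n j)

  sumTo-classes : ∀ n → sumTo n (classCount n) ≡ shapeCount n
  sumTo-classes n = begin
    sum (map (classCount n) (upTo (suc n)))                  ≡⟨ cong sum (map-applyUpTo (λ j → j) (classCount n) (suc n)) ⟩
    Σ< (suc n) (classCount n)                                ≡⟨ Σ<-length-filter countD (suc n) (representatives n) bounded ⟩
    length (representatives n)                               ≡⟨ length-map representative (shapes n) ⟩
    length (shapes n)                                        ≡⟨ length-shapes n ⟩
    shapeCount n                                             ∎
    where
    open ≡.≡-Reasoning
    bounded : All (λ r → countD r < suc n) (representatives n)
    bounded = All.tabulate λ {r} r∈ → s≤s (subst (countD r ≤_) (length-representatives n r∈) (countD≤length r))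

  sumTo-even : ∀ {n} m → 0 < n → n ≡ 2 * m → 8 * sumTo n (classCount n) + (3 * n + 42) * 2 ^ m ≡ 16 * fib (n + 4)
  sumTo-even zero    0<0 refl = contradiction 0<0 (ℕ.<-irrefl refl)
  sumTo-even (suc m) _   refl = begin
    8 * sumTo (2 * suc m) (classCount (2 * suc m)) + (3 * (2 * suc m) + 42) * 2 ^ suc m
      ≡⟨ cong (λ t → 8 * t + (3 * (2 * suc m) + 42) * 2 ^ suc m) (sumTo-classes (2 * suc m)) ⟩
    8 * shapeCount (2 * suc m) + (3 * (2 * suc m) + 42) * 2 ^ suc m
      ≡⟨ cong₂ (λ n c → 8 * shapeCount n + c * 2 ^ suc m) n≡ (coefficient m) ⟩
    8 * shapeCount (2 + twice m) + (6 * m + 48) * 2 ^ suc m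
      ≡⟨ proj₁ (shapeCount-closed m) ⟩
    16 * fib (6 + twice m)
      ≡⟨ cong (λ n → 16 * fib n) (trans (cong (_+ 4) n≡) (ℕ.+-comm (2 + twice m) 4)) ⟨
    16 * fib (2 * suc m + 4)
      ∎
    where
    open ≡.≡-Reasoning
    n≡ : 2 * suc m ≡ 2 + twice m
    n≡ = trans (ℕ.*-suc 2 m) (cong (2 +_) (sym (twice≡2* m)))
    coefficient : ∀ m → 3 * (2 * suc m) + 42 ≡ 6 * m + 48
    coefficient = solve-∀

  sumTo-odd : ∀ {n} m → n ≡ 2 * m + 1 → 2 * sumTo n (classCount n) + (n + 15) * 2 ^ m ≡ 4 * fib (n + 4)
  sumTo-odd m refl = begin
    2 * sumTo (2 * m + 1) (classCount (2 * m + 1)) + (2 * m + 1 + 15) * 2 ^ m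
      ≡⟨ cong (λ t → 2 * t + (2 * m + 1 + 15) * 2 ^ m) (sumTo-classes (2 * m + 1)) ⟩
    2 * shapeCount (2 * m + 1) + (2 * m + 1 + 15) * 2 ^ m
      ≡⟨ cong₂ (λ n c → 2 * shapeCount n + c * 2 ^ m) n≡ (coefficient m) ⟩
    2 * shapeCount (1 + twice m) + (2 * m + 16) * 2 ^ m
      ≡⟨ proj₂ (shapeCount-closed m) ⟩
    4 * fib (5 + twice m)
      ≡⟨ cong (λ n → 4 * fib n) (trans (cong (_+ 4) n≡) (ℕ.+-comm (1 + twice m) 4)) ⟨
    4 * fib (2 * m + 1 + 4)
      ∎
    where
    open ≡.≡-Reasoning
    n≡ : 2 * m + 1 ≡ 1 + twice m
    n≡ = trans (ℕ.+-comm (2 * m) 1) (cong suc (sym (twice≡2* m)))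
    coefficient : ∀ m → 2 * m + 1 + 15 ≡ 2 * m + 16
    coefficient = solve-∀


  canonical∈classes : ∀ {n j w} → WordsNK n j w → canonical w ∈ classes n j
  canonical∈classes {n} {j} {w} (length≡n , countD≡j) =
    ∈-filter⁺ _ (∈-map⁺ representative (subst (λ m → shapeOf w ∈ shapes m) size≡n (complete (shapeOf w)))) countD≡
    where
    open EnumeratesBySize shapes-enumerates
    size≡n : size (shapeOf w) ≡ n
    size≡n = trans (sym (length-representative (shapeOf w))) (trans (length-canonical w) length≡n)
    countD≡ : countD (canonical w) ≡ j
    countD≡ = begin
      countD (canonical w)                ≡⟨ countD≡length-downHeights (canonical w) ⟩
      length (downHeights (canonical w))  ≡⟨ ↭.↭-length (downHeights-canonical w) ⟨
      length (downHeights w)              ≡⟨ countD≡length-downHeights w ⟨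
      countD w                            ≡⟨ countD≡j ⟩
      j                                   ∎
      where open ≡.≡-Reasoning

  module _ {c ℓ : Level} (R : CommutativeRing c ℓ) (F : IsFieldChar0 R) where
    open Characteristic0 R F using (weylEquiv⇒downHeights-↭)
    open WeylAlgebra R using (downHeights-↭⇒weylEquiv)

    representatives-inequivalent : ∀ {σ σ′} → size σ ≡ size σ′ → σ ≢ σ′ →
                                   ¬ WeylEquiv R (representative σ) (representative σ′)
    representatives-inequivalent {σ} {σ′} sσ≡sσ′ σ≢σ′ rσ~rσ′ =
      σ≢σ′ (representative-injective σ σ′ (height-determined {r} {r′} lengths≡ downHeights↭) downHeights↭)
      where
      r = representative σ
      r′ = representative σ′
      downHeights↭ = weylEquiv⇒downHeights-↭ {r} {r′} rσ~rσ′
      lengths≡ = trans (length-representative σ) (trans sσ≡sσ′ (sym (length-representative σ′)))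

    representatives-pairwise : ∀ n → AllPairs (λ u v → ¬ WeylEquiv R u v) (representatives n)
    representatives-pairwise n = AllPairs.map⁺ (go (unique n) (All.tabulate sound))
      where
      open EnumeratesBySize shapes-enumerates
      go : ∀ {L} → Unique L → All (λ σ → size σ ≡ n) L →
           AllPairs (λ σ σ′ → ¬ WeylEquiv R (representative σ) (representative σ′)) L
      go []         []        = []
      go (σ∉ ∷ uL) (sσ ∷ sL) =
        All.zipWith (λ (σ≢σ′ , sσ′) → representatives-inequivalent (trans sσ (sym sσ′)) σ≢σ′) (σ∉ , sL) ∷ go uL sL

    classes-numClasses : ∀ n j → NumClasses (WeylEquiv R) (WordsNK n j) (classCount n j)
    classes-numClasses n j =
      classes n j , refl , members , AllPairs.filter⁺ _ (representatives-pairwise n) , covered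
      where
      members : All (WordsNK n j) (classes n j)
      members = All.tabulate λ r∈ →
        let r∈reps , countD≡j = ∈-filter⁻ _ r∈ in length-representatives n r∈reps , countD≡j
      covered : ∀ w → WordsNK n j w → Any (WeylEquiv R w) (classes n j)
      covered w w∈ = Any.map (λ w′≡ → subst (WeylEquiv R w) w′≡ w~canonical) (canonical∈classes {n} {j} {w} w∈)
        where
        w~canonical : WeylEquiv R w (canonical w)
        w~canonical = downHeights-↭⇒weylEquiv {w} {canonical w} (sym (height-canonical w)) (downHeights-canonical w)

open Classes

open import Data.Nat using (_+_; _*_; _^_; _≤_; _<_)

corollary6p7 : {c ℓ : Level} (k : CommutativeRing c ℓ) → IsFieldChar0 k →
    (n : ℕ) → 0 < n →
    Σ (ℕ → ℕ) λ a →
      (∀ j → j ≤ n → NumClasses (WeylEquiv k) (WordsNK n j) (a j)) ×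
      (∀ m → n ≡ 2 * m →
        8 * sumTo n a + (3 * n + 42) * 2 ^ m ≡ 16 * fib (n + 4)) ×
      (∀ m → n ≡ 2 * m + 1 →
        2 * sumTo n a + (n + 15) * 2 ^ m ≡ 4 * fib (n + 4))
corollary6p7 k F n 0<n = classCount n , (λ j _ → classes-numClasses k F n j) , (λ m → sumTo-even m 0<n) , sumTo-odd
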